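{- Let $A$ be a unimodular integer matrix and $\mathcal{L}=\ker(A)\cap\mathbf{Z}^n$. Then $P_{\mathcal{L}}=V_{\mathcal{L}}$, and both coincide with the Stanley–Reisner ideal $I_{\Delta(\mathcal{M}(\mathcal{L}))}$ of the matroid complex $\Delta(\mathcal{M}(\mathcal{L}))$.
   Context: A $d\times n$ integer matrix of rank $d$ is unimodular if all its maximal $d\times d$ minors have the same absolute value (nonzero ones). $S=k[x_1,\ldots,x_n]$, $x^u=\prod_i x_i^{u_i}$. For $u\in\mathbf{N}^n$ the fiber is $P_u=\mathrm{conv}\{v\in\mathbf{N}^n: u-v\in\mathcal{L}\}$; the vertex ideal $V_{\mathcal{L}}$ is the monomial ideal spanned by monomials $x^v$ with $v$ not a vertex of $P_v$. Graver basis $Gr_{\mathcal{L}}$: the union over all closed orthants $\mathbf{R}_\rho$ ($\rho\in\{+,-\}^n$) of the Hilbert basis (unique minimal monoid generating set) of $\mathcal{L}\cap\mathbf{R}_\rho$. The product ideal is $P_{\mathcal{L}}=\langle x^ux^v : u,v\in\mathbf{N}^n,\ u-v\in Gr_{\mathcal{L}}\rangle$ (here $u,v$ are the positive and negative parts of the Graver element). Let $m=\dim\mathcal{L}$ and $B\in\mathbf{Z}^{n\times m}$ have columns forming a basis of $\mathcal{L}$ with rows $b_1,\ldots,b_n$; $\mathcal{M}(\mathcal{L})$ is the matroid on $[n]$ whose maximal independent sets are the complements of the $m$-subsets $\sigma$ with $\{b_i: i\in\sigma\}$ linearly independent (equivalently, $\mathcal{M}(\mathcal{L})$ is the matroid of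 linearly independent subsets of columns of $A$). $\Delta(\mathcal{M})$ is the simplicial complex of independent sets, and the Stanley–Reisner ideal is generated by the squarefree monomials of the non-faces. -}

module Defs where

open import Data.Nat as ℕ using (ℕ; zero; suc)
open import Data.Integer as ℤ using (ℤ; +_; -[1+_]; ∣_∣)
open import Data.Rational as ℚ using (ℚ; 0ℚ; 1ℚ)
open import Data.Fin using (Fin; zero; suc; punchIn)
open import Data.Fin.Subset using (Subset; _∈_; _∉_)
open import Data.Sign using (Sign)
open import Data.List using (List; []; _∷_; map)
open import Data.List.Relation.Unary.All using (All)
open import Data.Product using (Σ; ∃; _×_; _,_; proj₁; proj₂)
open import Relation.Binary.PropositionalEquality using (_≡_)
open import Relation.Nullary using (¬_)

Matrix : ℕ → ℕ → Set
Matrix d n = Fin d → Fin n → ℤ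

sumℤ : ∀ {k} → (Fin k → ℤ) → ℤ
sumℤ {zero}  f = + 0
sumℤ {suc k} f = f zero ℤ.+ sumℤ (λ i → f (suc i))

altSum : ∀ {k} → (Fin k → ℤ) → ℤ
altSum {zero}  f = + 0
altSum {suc k} f = f zero ℤ.- altSum (λ i → f (suc i))

det : ∀ {d} → Matrix d d → ℤ
det {zero}  M = + 1
det {suc d} M = altSum (λ j → M zero j ℤ.* det (λ r c → M (suc r) (punchIn j c)))

_·_ : ∀ {d n} → Matrix d n → (Fin n → ℤ) → Fin d → ℤ
(A · x) i = sumℤ (λ j → A i j ℤ.* x j)

RankFull : ∀ {d n} → Matrix d n → Set
RankFull {d} {n} A =
  (y : Fin d → ℤ) → (∀ j → sumℤ (λ i → y i ℤ.* A i j) ≡ + 0) → ∀ i → y i ≡ + 0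

-- strictly increasing σ : Fin d → Fin n, i.e. a d-subset of the columns
Increasing : ∀ {d n} → (Fin d → Fin n) → Set
Increasing σ = ∀ i j → i Data.Fin.< j → σ i Data.Fin.< σ j

minor : ∀ {d n} → Matrix d n → (Fin d → Fin n) → ℤ
minor A σ = det (λ i j → A i (σ j))

Unimodular : ∀ {d n} → Matrix d n → Set
Unimodular {d} {n} A =
  RankFull A ×
  ((σ τ : Fin d → Fin n) → Increasing σ → Increasing τ →
     ¬ (minor A σ ≡ + 0) → ¬ (minor A τ ≡ + 0) → ∣ minor A σ ∣ ≡ ∣ minor A τ ∣)

InL : ∀ {d n} → Matrix d n → (Fin n → ℤ) → Set
InL A x = ∀ i → (A · x) i ≡ + 0

IsZero : ∀ {n} → (Fin n → ℤ) → Set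
IsZero x = ∀ i → x i ≡ + 0

InOrthant : ∀ {n} → (Fin n → Sign) → (Fin n → ℤ) → Set
InOrthant ρ x = ∀ i → (ρ i ≡ Sign.+ → + 0 ℤ.≤ x i) × (ρ i ≡ Sign.- → x i ℤ.≤ + 0)

InCone : ∀ {d n} → Matrix d n → (Fin n → Sign) → (Fin n → ℤ) → Set
InCone A ρ x = InL A x × InOrthant ρ x

-- Hilbert basis of the pointed monoid L ∩ R_ρ: its irreducible elements
-- (nonzero, not a sum of two nonzero elements of the monoid)
InHilbertBasis : ∀ {d n} → Matrix d n → (Fin n → Sign) → (Fin n → ℤ) → Set
InHilbertBasis {d} {n} A ρ x =
  InCone A ρ x × ¬ IsZero x ×
  ¬ (Σ (Fin n → ℤ) λ y → Σ (Fin n → ℤ) λ z →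
       InCone A ρ y × InCone A ρ z × ¬ IsZero y × ¬ IsZero z ×
       (∀ i → x i ≡ y i ℤ.+ z i))

InGraver : ∀ {d n} → Matrix d n → (Fin n → ℤ) → Set
InGraver {d} {n} A g = Σ (Fin n → Sign) λ ρ → InHilbertBasis A ρ g

pos : ℤ → ℕ
pos (+ k)     = k
pos -[1+ k ]  = 0

neg : ℤ → ℕ
neg (+ k)     = 0
neg -[1+ k ]  = suc k

-- Monomial ideals, represented by the set of exponent vectors of the
-- monomials they contain.  x^a divides x^w  iff  a ≤ w componentwise.

Exp : ℕ → Set
Exp n = Fin n → ℕ

Divides : ∀ {n} → Exp n → Exp n → Set
Divides a w = ∀ i → a i ℕ.≤ w i

-- x^w ∈ P_L = ⟨ x^{g⁺} x^{g⁻} : g ∈ Gr_L ⟩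
InProductIdeal : ∀ {d n} → Matrix d n → Exp n → Set
InProductIdeal {d} {n} A w =
  Σ (Fin n → ℤ) λ g → InGraver A g × Divides (λ i → pos (g i) ℕ.+ neg (g i)) w

-- fiber: v' ∈ P_v ∩ ℕⁿ  iff  v - v' ∈ L
toℤ : ∀ {n} → Exp n → Fin n → ℤ
toℤ v i = + (v i)

InFiber : ∀ {d n} → Matrix d n → Exp n → Exp n → Set
InFiber A v w = ∀ i → (A · toℤ w) i ≡ (A · toℤ v) i

toℚ : ℕ → ℚ
toℚ k = (+ k) ℚ./ 1

sumℚ : List ℚ → ℚ
sumℚ []       = 0ℚ
sumℚ (q ∷ qs) = q ℚ.+ sumℚ qs

InConvOthers : ∀ {d n} → Matrix d n → Exp n → Set
InConvOthers {d} {n} A v =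
  Σ (List (ℚ × Exp n)) λ cs →
    All (λ c → (0ℚ ℚ.≤ proj₁ c) × InFiber A v (proj₂ c) × ¬ (∀ i → proj₂ c i ≡ v i)) cs ×
    sumℚ (map proj₁ cs) ≡ 1ℚ ×
    (∀ i → sumℚ (map (λ c → proj₁ c ℚ.* toℚ (proj₂ c i)) cs) ≡ toℚ (v i))

-- v is a vertex of P_v = conv{ v' ∈ ℕⁿ : v - v' ∈ L }
IsVertex : ∀ {d n} → Matrix d n → Exp n → Set
IsVertex A v = ¬ InConvOthers A v

-- x^w ∈ V_L (k-span of the monomials x^v with v not a vertex of P_v)
InVertexIdeal : ∀ {d n} → Matrix d n → Exp n → Set
InVertexIdeal A w = ¬ IsVertex A w

-- The matroid M(L): F ⊆ [n] is independent iff the columns of A indexed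
-- by F are linearly independent.

Independent : ∀ {d n} → Matrix d n → Subset n → Set
Independent {d} {n} A F =
  (c : Fin n → ℤ) → (∀ i → i ∉ F → c i ≡ + 0) → InL A c → IsZero c

-- x^w ∈ I_Δ = ⟨ x^F : F a non-face of Δ(M(L)) ⟩
InStanleyReisner : ∀ {d n} → Matrix d n → Exp n → Set
InStanleyReisner {d} {n} A w =
  Σ (Subset n) λ F → ¬ Independent A F × (∀ i → i ∈ F → 1 ℕ.≤ w i)

{-# OPTIONS --safe #-}
-- For a Graver element g with g⁺ + g⁻ ≤ w, the exponent w is the midpoint of the two other fiber
-- points w + g and w − g, so P ⊆ V. If w is not a vertex, a fiber point v ≠ w of positive weight in a
-- convex combination for w has supp v ⊆ supp w, and v − w is a nonzero kernel vector supported on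
-- supp w; hence V ⊆ I_Δ. Conversely a dependent set F contains the support of a circuit c. Extend
-- supp c ∖ {j} to a basis J; Cramer's rule on the d + 1 columns J ∪ {j} gives a kernel vector
-- supported on supp c whose nonzero entries are ± maximal minors, which unimodularity makes equal in
-- absolute value, so c may be taken with entries in {0, ±1}. Such a circuit is not a conformal sum of
-- two nonzero kernel vectors, so it is a Graver element, dividing x^w when F ⊆ supp w: I_Δ ⊆ P.
-- The existence arguments are classical; the Graver element is then found by exhaustive search.
module Submission where

open import Defs
open import Data.Nat as ℕ using (ℕ; zero; suc; s≤s; z≤n)
import Data.Nat.Properties as ℕ
open import Data.Integer as ℤ using (ℤ; +_; -[1+_]; ∣_∣; _+_; _*_; -_; _-_; _^_; +≤+; -≤+)
import Data.Integer.Properties as ℤ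
open import Data.Integer.Tactic.RingSolver using (solve-∀)
open import Data.Rational as ℚ using (ℚ; 0ℚ; 1ℚ; ½)
import Data.Rational.Properties as ℚ
open import Data.Rational.Unnormalised as ℚᵘ using (mkℚᵘ; *≡*)
import Data.Rational.Unnormalised.Properties as ℚᵘ
open import Data.Rational.Solver using (module +-*-Solver)
open import Data.Sign as Sign using (Sign)
open import Data.Fin as Fin using (Fin; zero; suc; punchIn; punchOut)
import Data.Fin.Properties as Fin
open import Data.Fin.Subset using (Subset; _∈_; _∉_; _⊆_; _⊂_; _∪_; ⁅_⁆)
open import Data.Fin.Subset.Properties
  using (_∈?_; anySubset?; p⊆p∪q; q⊆p∪q; x∈p∪q⁻; x∈p∪q⁺; x∈⁅x⁆; x∈⁅y⁆⇒x≡y)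
open import Data.Fin.Subset.Induction using (⊂-wellFounded)
import Data.Vec as Vec
import Data.Vec.Properties as Vec
open import Data.Vec.Functional using (insertAt)
open import Data.Vec.Functional.Properties using (insertAt-lookup; insertAt-punchIn)
open import Data.List as List using (List; []; _∷_; _++_; map; length; tabulate; filter; allFin; lookup)
import Data.List.Properties as List
open import Data.List.Membership.Propositional using (find) renaming (_∈_ to _∈ₗ_)
open import Data.List.Membership.Propositional.Properties
  using (∈-tabulate⁺; ∈-∃++; ∈-filter⁺; ∈-filter⁻; ∈-allFin; ∈-lookup)
open import Data.List.Relation.Unary.Any as Any using (here; there; index)
open import Data.List.Relation.Unary.Any.Properties using (lookup-index)
open import Data.List.Relation.Unary.All as All using (All; []; _∷_)
import Data.List.Relation.Unary.All.Properties as All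
open import Data.List.Relation.Unary.AllPairs as AllPairs using (AllPairs; []; _∷_)
import Data.List.Relation.Unary.AllPairs.Properties as AllPairs
open import Data.Product using (Σ; ∃-syntax; _×_; _,_; proj₁; proj₂)
open import Data.Sum as Sum using (_⊎_; inj₁; inj₂)
open import Data.Unit using (tt)
open import Effect.Monad using (RawMonad)
open import Function.Base using (_∘_; id)
open import Function.Bundles using (_⇔_; mk⇔)
open import Function.Definitions using (Injective)
open import Induction.WellFounded using (Acc; acc)
import Level
open import Relation.Binary.Definitions using (tri<; tri≈; tri>)
open import Relation.Binary.PropositionalEquality
open import Relation.Nullary using (¬_; Dec; yes; no; does; contradiction)
open import Relation.Nullary.Decidable
  using (¬?; _×-dec_; _→-dec_; dec-true; decidable-stable; ¬¬-excluded-middle; toWitness)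
open import Relation.Nullary.Negation using (¬¬-Monad)
open import Relation.Unary using (Decidable)
import Algebra.Properties.CommutativeMonoid.Sum ℤ.+-0-commutativeMonoid as Σℤ
import Algebra.Properties.Semiring.Sum ℤ.+-*-semiring as Σℤ*

open RawMonad (¬¬-Monad {a = Level.zero}) using (_>>=_; pure)

sumℤ≡sum : ∀ {k} (f : Fin k → ℤ) → sumℤ f ≡ Σℤ.sum f
sumℤ≡sum {zero}  f = refl
sumℤ≡sum {suc k} f = cong (λ t → f zero + t) (sumℤ≡sum (f ∘ suc))

sumℤ-cong : ∀ {k} {f g : Fin k → ℤ} → (∀ i → f i ≡ g i) → sumℤ f ≡ sumℤ g
sumℤ-cong {zero}  f≗g = refl
sumℤ-cong {suc k} f≗g = cong₂ _+_ (f≗g zero) (sumℤ-cong (f≗g ∘ suc))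

sumℤ-zero : ∀ {k} (f : Fin k → ℤ) → (∀ i → f i ≡ + 0) → sumℤ f ≡ + 0
sumℤ-zero {k} f f≗0 = trans (sumℤ-cong {k} f≗0) (trans (sumℤ≡sum {k} (λ _ → + 0)) (Σℤ.sum-replicate-zero k))

sumℤ-distrib-+ : ∀ {k} (f g : Fin k → ℤ) → sumℤ (λ i → f i + g i) ≡ sumℤ f + sumℤ g
sumℤ-distrib-+ f g rewrite sumℤ≡sum (λ i → f i + g i) | sumℤ≡sum f | sumℤ≡sum g = Σℤ.∑-distrib-+ f g

*-distribˡ-sumℤ : ∀ {k} a (f : Fin k → ℤ) → a * sumℤ f ≡ sumℤ (λ i → a * f i)
*-distribˡ-sumℤ a f rewrite sumℤ≡sum f | sumℤ≡sum (λ i → a * f i) = Σℤ*.*-distribˡ-sum a f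

*-distribʳ-sumℤ : ∀ {k} a (f : Fin k → ℤ) → sumℤ f * a ≡ sumℤ (λ i → f i * a)
*-distribʳ-sumℤ a f rewrite sumℤ≡sum f | sumℤ≡sum (λ i → f i * a) = Σℤ*.*-distribʳ-sum a f

sumℤ-neg : ∀ {k} (f : Fin k → ℤ) → sumℤ (λ i → - f i) ≡ - sumℤ f
sumℤ-neg f = begin
  sumℤ (λ i → - f i)        ≡⟨ sumℤ-cong (λ i → sym (ℤ.-1*i≡-i (f i))) ⟩
  sumℤ (λ i → - + 1 * f i)  ≡⟨ *-distribˡ-sumℤ (- + 1) f ⟨
  - + 1 * sumℤ f            ≡⟨ ℤ.-1*i≡-i _ ⟩
  - sumℤ f                  ∎
  where open ≡-Reasoning

sumℤ-distrib-- : ∀ {k} (f g : Fin k → ℤ) → sumℤ (λ i → f i - g i) ≡ sumℤ f - sumℤ g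
sumℤ-distrib-- f g = trans (sumℤ-distrib-+ f (λ i → - g i)) (cong (λ t → sumℤ f + t) (sumℤ-neg g))

sumℤ-comm : ∀ {k l} (f : Fin k → Fin l → ℤ) →
            sumℤ (λ i → sumℤ (f i)) ≡ sumℤ (λ j → sumℤ (λ i → f i j))
sumℤ-comm f rewrite sumℤ-cong (λ i → sumℤ≡sum (f i)) | sumℤ≡sum (λ i → Σℤ.sum (f i))
                  | sumℤ-cong (λ j → sumℤ≡sum (λ i → f i j)) | sumℤ≡sum (λ j → Σℤ.sum (λ i → f i j))
  = Σℤ.∑-comm f

sumℤ-remove : ∀ {k} (f : Fin (suc k) → ℤ) j → sumℤ f ≡ f j + sumℤ (f ∘ punchIn j)
sumℤ-remove f j rewrite sumℤ≡sum f | sumℤ≡sum (f ∘ punchIn j) = Σℤ.sum-remove f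

sumℤ-single : ∀ {k} (f : Fin k → ℤ) j → (∀ i → i ≢ j → f i ≡ + 0) → sumℤ f ≡ f j
sumℤ-single {suc k} f j f≗0 = begin
  sumℤ f                     ≡⟨ sumℤ-remove f j ⟩
  f j + sumℤ (f ∘ punchIn j)  ≡⟨ cong (λ t → f j + t) (sumℤ-zero _ (λ i → f≗0 _ (Fin.punchInᵢ≢i j i))) ⟩
  f j + + 0                  ≡⟨ ℤ.+-identityʳ (f j) ⟩
  f j                        ∎
  where open ≡-Reasoning

infix 7 _⋅_
_⋅_ : ∀ {k} → (Fin k → ℤ) → (Fin k → ℤ) → ℤ
ρ ⋅ x = sumℤ (λ c → ρ c * x c)

⋅-linear : ∀ {k} a b (u v x : Fin k → ℤ) → (λ c → a * u c + b * v c) ⋅ x ≡ a * (u ⋅ x) + b * (v ⋅ x)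
⋅-linear a b u v x = begin
  sumℤ (λ c → (a * u c + b * v c) * x c)         ≡⟨ sumℤ-cong (λ c → lemma a b (u c) (v c) (x c)) ⟩
  sumℤ (λ c → a * (u c * x c) + b * (v c * x c)) ≡⟨ sumℤ-distrib-+ (λ c → a * (u c * x c)) (λ c → b * (v c * x c)) ⟩
  sumℤ (λ c → a * (u c * x c)) + sumℤ (λ c → b * (v c * x c))
    ≡⟨ cong₂ _+_ (*-distribˡ-sumℤ a (λ c → u c * x c)) (*-distribˡ-sumℤ b (λ c → v c * x c)) ⟨
  a * (u ⋅ x) + b * (v ⋅ x)                      ∎
  where
  open ≡-Reasoning
  lemma : ∀ a b u v x → (a * u + b * v) * x ≡ a * (u * x) + b * (v * x)
  lemma = solve-∀

i≡0⇒i*j≡0 : ∀ {i} j → i ≡ + 0 → i * j ≡ + 0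
i≡0⇒i*j≡0 j refl = ℤ.*-zeroˡ j

j≡0⇒i*j≡0 : ∀ i {j} → j ≡ + 0 → i * j ≡ + 0
j≡0⇒i*j≡0 i refl = ℤ.*-zeroʳ i

i*j≡0⇒j≡0 : ∀ {i j} → i ≢ + 0 → i * j ≡ + 0 → j ≡ + 0
i*j≡0⇒j≡0 {i} i≢0 ij≡0 with ℤ.i*j≡0⇒i≡0∨j≡0 i ij≡0
... | inj₁ i≡0 = contradiction i≡0 i≢0
... | inj₂ j≡0 = j≡0

IsZero? : ∀ {n} (x : Fin n → ℤ) → Dec (IsZero x)
IsZero? x = Fin.all? (λ m → x m ℤ.≟ + 0)

nonzero-entry? : ∀ {k} (ρ : Fin k → ℤ) → (∀ j → ρ j ≡ + 0) ⊎ (∃[ j ] ρ j ≢ + 0)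
nonzero-entry? ρ with Fin.any? (λ j → ¬? (ρ j ℤ.≟ + 0))
... | yes found = inj₂ found
... | no none   = inj₁ (λ j → decidable-stable (ρ j ℤ.≟ + 0) (λ ρj≢0 → none (j , ρj≢0)))

-- Determinants

-- detL rs cs is the determinant of the rows rs restricted to the columns cs, expanded along the first
-- row (zero when the sizes differ); in expand r ψ, ψ gives the minors of the remaining rows. On lists,
-- swapping two adjacent rows is a local operation, which is how the alternating law is proved.
expand : ∀ {n} → (Fin n → ℤ) → (List (Fin n) → ℤ) → List (Fin n) → ℤ
expand r ψ []       = + 0
expand r ψ (c ∷ cs) = r c * ψ cs - expand r (ψ ∘ (c ∷_)) cs

detL : ∀ {n} → List (Fin n → ℤ) → List (Fin n) → ℤ
detL []       []      = + 1
detL []       (_ ∷ _) = + 0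
detL (r ∷ rs) cs      = expand r (detL rs) cs

x*0-0≡0 : ∀ x → x * + 0 - + 0 ≡ + 0
x*0-0≡0 = solve-∀

0≡a*0+b*0 : ∀ a b → + 0 ≡ a * + 0 + b * + 0
0≡a*0+b*0 = solve-∀

expand-cong : ∀ {n} r {ψ φ : List (Fin n) → ℤ} → (∀ v → ψ v ≡ φ v) → ∀ cs → expand r ψ cs ≡ expand r φ cs
expand-cong r ψ≗φ []       = refl
expand-cong r ψ≗φ (c ∷ cs) = cong₂ (λ x y → r c * x - y) (ψ≗φ cs) (expand-cong r (ψ≗φ ∘ (c ∷_)) cs)

expand-zero : ∀ {n} r (ψ : List (Fin n) → ℤ) → (∀ v → ψ v ≡ + 0) → ∀ cs → expand r ψ cs ≡ + 0
expand-zero r ψ ψ≗0 []       = refl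
expand-zero r ψ ψ≗0 (c ∷ cs) rewrite ψ≗0 cs | expand-zero r (ψ ∘ (c ∷_)) (ψ≗0 ∘ (c ∷_)) cs =
  x*0-0≡0 (r c)

expand-linear : ∀ {n} r a b (ψ φ : List (Fin n) → ℤ) cs →
                expand r (λ v → a * ψ v + b * φ v) cs ≡ a * expand r ψ cs + b * expand r φ cs
expand-linear r a b ψ φ []       = 0≡a*0+b*0 a b
expand-linear r a b ψ φ (c ∷ cs) rewrite expand-linear r a b (ψ ∘ (c ∷_)) (φ ∘ (c ∷_)) cs =
  lemma (r c) a b (ψ cs) (φ cs) _ _
  where lemma : ∀ x a b p q s t → x * (a * p + b * q) - (a * s + b * t) ≡ a * (x * p - s) + b * (x * q - t)
        lemma = solve-∀

expand-linear-row : ∀ {n} (r s : Fin n → ℤ) a b ψ cs →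
                    expand (λ c → a * r c + b * s c) ψ cs ≡ a * expand r ψ cs + b * expand s ψ cs
expand-linear-row r s a b ψ []       = 0≡a*0+b*0 a b
expand-linear-row r s a b ψ (c ∷ cs) rewrite expand-linear-row r s a b (ψ ∘ (c ∷_)) cs =
  lemma (r c) (s c) a b (ψ cs) _ _
  where lemma : ∀ x y a b p s t → (a * x + b * y) * p - (a * s + b * t) ≡ a * (x * p - s) + b * (y * p - t)
        lemma = solve-∀

expand-neg : ∀ {n} r (ψ : List (Fin n) → ℤ) cs → expand r (λ v → - ψ v) cs ≡ - expand r ψ cs
expand-neg r ψ []       = refl
expand-neg r ψ (c ∷ cs) rewrite expand-neg r (ψ ∘ (c ∷_)) cs = lemma (r c) (ψ cs) _
  where lemma : ∀ x p s → x * (- p) - (- s) ≡ - (x * p - s)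
        lemma = solve-∀

expand-anticomm : ∀ {n} (r s : Fin n → ℤ) ψ cs →
                  expand r (expand s ψ) cs ≡ - expand s (expand r ψ) cs
expand-anticomm r s ψ []       = refl
expand-anticomm r s ψ (c ∷ cs) = begin
  r c * expand s ψ cs - expand r (λ v → s c * ψ v - expand s ψc v) cs
    ≡⟨ cong (λ t → r c * expand s ψ cs - t) (peel r s) ⟩
  r c * expand s ψ cs - (s c * expand r ψ cs + - + 1 * expand r (expand s ψc) cs)
    ≡⟨ cong (λ t → r c * expand s ψ cs - (s c * expand r ψ cs + - + 1 * t)) (expand-anticomm r s ψc cs) ⟩
  r c * expand s ψ cs - (s c * expand r ψ cs + - + 1 * - expand s (expand r ψc) cs)
    ≡⟨ lemma (r c) (s c) (expand s ψ cs) (expand r ψ cs) (expand s (expand r ψc) cs) ⟩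
  - (s c * expand r ψ cs - (r c * expand s ψ cs + - + 1 * expand s (expand r ψc) cs))
    ≡⟨ cong (λ t → - (s c * expand r ψ cs - t)) (peel s r) ⟨
  - (s c * expand r ψ cs - expand s (λ v → r c * ψ v - expand r ψc v) cs) ∎
  where
  open ≡-Reasoning
  ψc = ψ ∘ (c ∷_)
  sub≡+neg : ∀ a p q → a * p - q ≡ a * p + - + 1 * q
  sub≡+neg = solve-∀
  peel : ∀ r s → expand r (λ v → s c * ψ v - expand s ψc v) cs ≡
                 s c * expand r ψ cs + - + 1 * expand r (expand s ψc) cs
  peel r s = trans (expand-cong r (λ v → sub≡+neg (s c) (ψ v) (expand s ψc v)) cs)
                   (expand-linear r (s c) (- + 1) ψ (expand s ψc) cs)
  lemma : ∀ x y p q t → x * p - (y * q + - + 1 * - t) ≡ - (y * q - (x * p + - + 1 * t))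
  lemma = solve-∀

detL-swap : ∀ {n} (P : List (Fin n → ℤ)) x y Q cs → detL (P ++ x ∷ y ∷ Q) cs ≡ - detL (P ++ y ∷ x ∷ Q) cs
detL-swap []      x y Q cs = expand-anticomm x y (detL Q) cs
detL-swap (p ∷ P) x y Q cs = trans (expand-cong p (detL-swap P x y Q) cs) (expand-neg p _ cs)

detL-repeated-row : ∀ {n} (P : List (Fin n → ℤ)) x M Q cs → detL (P ++ x ∷ M ++ x ∷ Q) cs ≡ + 0
detL-repeated-row P x []      Q cs = self-neg⇒0 (detL-swap P x x Q cs)
  where self-neg⇒0 : ∀ {t} → t ≡ - t → t ≡ + 0
        self-neg⇒0 {+ zero}   _ = refl
        self-neg⇒0 {+ suc _}  ()
        self-neg⇒0 { -[1+ _ ]} ()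
detL-repeated-row P x (m ∷ M) Q cs = begin
  detL (P ++ x ∷ m ∷ M ++ x ∷ Q) cs     ≡⟨ detL-swap P x m (M ++ x ∷ Q) cs ⟩
  - detL (P ++ m ∷ x ∷ M ++ x ∷ Q) cs   ≡⟨ cong (λ t → - detL t cs) (List.++-assoc P (m ∷ []) _) ⟨
  - detL ((P ++ m ∷ []) ++ x ∷ M ++ x ∷ Q) cs ≡⟨ cong -_ (detL-repeated-row (P ++ m ∷ []) x M Q cs) ⟩
  + 0                                   ∎
  where open ≡-Reasoning

detL-linear : ∀ {n} (P : List (Fin n → ℤ)) a b u v Q cs →
              detL (P ++ (λ c → a * u c + b * v c) ∷ Q) cs ≡ a * detL (P ++ u ∷ Q) cs + b * detL (P ++ v ∷ Q) cs
detL-linear []      a b u v Q cs = expand-linear-row u v a b (detL Q) cs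
detL-linear (p ∷ P) a b u v Q cs = trans (expand-cong p (detL-linear P a b u v Q) cs)
                                         (expand-linear p a b (detL (P ++ u ∷ Q)) (detL (P ++ v ∷ Q)) cs)

detL-eliminate : ∀ {n} (r : Fin n → ℤ) a (b : (Fin n → ℤ) → ℤ) (P Q : List (Fin n → ℤ)) cs →
                 detL (r ∷ P ++ map (λ q c → a * q c + b q * r c) Q) cs ≡ a ^ length Q * detL (r ∷ P ++ Q) cs
detL-eliminate r a b P []      cs = sym (ℤ.*-identityˡ _)
detL-eliminate r a b P (q ∷ Q) cs = begin
  detL ((r ∷ P) ++ (λ c → a * q c + b q * r c) ∷ map f Q) cs
    ≡⟨ detL-linear (r ∷ P) a (b q) q r (map f Q) cs ⟩
  a * detL (r ∷ P ++ q ∷ map f Q) cs + b q * detL ((r ∷ P) ++ r ∷ map f Q) cs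
    ≡⟨ cong (λ t → a * detL (r ∷ P ++ q ∷ map f Q) cs + b q * t) (detL-repeated-row [] r P (map f Q) cs) ⟩
  a * detL (r ∷ P ++ q ∷ map f Q) cs + b q * + 0
    ≡⟨ cong (λ t → a * detL (r ∷ t) cs + b q * + 0) (List.++-assoc P (q ∷ []) (map f Q)) ⟨
  a * detL (r ∷ (P ++ q ∷ []) ++ map f Q) cs + b q * + 0
    ≡⟨ cong (λ t → a * t + b q * + 0) (detL-eliminate r a b (P ++ q ∷ []) Q cs) ⟩
  a * (a ^ length Q * detL (r ∷ (P ++ q ∷ []) ++ Q) cs) + b q * + 0
    ≡⟨ cong (λ t → a * (a ^ length Q * detL (r ∷ t) cs) + b q * + 0) (List.++-assoc P (q ∷ []) Q) ⟩
  a * (a ^ length Q * detL (r ∷ P ++ q ∷ Q) cs) + b q * + 0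
    ≡⟨ lemma a (a ^ length Q) _ (b q) ⟩
  a * a ^ length Q * detL (r ∷ P ++ q ∷ Q) cs ∎
  where
  open ≡-Reasoning
  f = λ q c → a * q c + b q * r c
  lemma : ∀ a p d x → a * (p * d) + x * + 0 ≡ a * p * d
  lemma = solve-∀

expand-zero-column : ∀ {n} r (ψ : List (Fin n) → ℤ) j → r j ≡ + 0 → (∀ v → j ∈ₗ v → ψ v ≡ + 0) →
                     ∀ cs → j ∈ₗ cs → expand r ψ cs ≡ + 0
expand-zero-column r ψ j rj≡0 ψ≡0 (c ∷ cs) (here refl)
  rewrite rj≡0 | expand-zero r (ψ ∘ (j ∷_)) (λ v → ψ≡0 (j ∷ v) (here refl)) cs = lemma (ψ cs)
  where lemma : ∀ x → + 0 * x - + 0 ≡ + 0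
        lemma = solve-∀
expand-zero-column r ψ j rj≡0 ψ≡0 (c ∷ cs) (there j∈cs)
  rewrite ψ≡0 cs j∈cs | expand-zero-column r (ψ ∘ (c ∷_)) j rj≡0 (λ v → ψ≡0 (c ∷ v) ∘ there) cs j∈cs =
  x*0-0≡0 (r c)

detL-zero-column : ∀ {n} j (rs : List (Fin n → ℤ)) → All (λ r → r j ≡ + 0) rs →
                   ∀ cs → j ∈ₗ cs → detL rs cs ≡ + 0
detL-zero-column j []       []           (c ∷ cs) j∈cs = refl
detL-zero-column j (r ∷ rs) (rj≡0 ∷ rs≡0) cs      j∈cs =
  expand-zero-column r (detL rs) j rj≡0 (detL-zero-column j rs rs≡0) cs j∈cs

altSum-cong : ∀ {k} {f g : Fin k → ℤ} → (∀ i → f i ≡ g i) → altSum f ≡ altSum g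
altSum-cong {zero}  f≗g = refl
altSum-cong {suc k} f≗g = cong₂ _-_ (f≗g zero) (altSum-cong (f≗g ∘ suc))

expand-tabulate : ∀ {n m} r ψ (σ : Fin (suc m) → Fin n) →
                  expand r ψ (tabulate σ) ≡ altSum (λ j → r (σ j) * ψ (tabulate (σ ∘ punchIn j)))
expand-tabulate {m = zero}  r ψ σ = refl
expand-tabulate {m = suc m} r ψ σ =
  cong (λ t → r (σ zero) * ψ (tabulate (σ ∘ suc)) - t) (expand-tabulate r (ψ ∘ (σ zero ∷_)) (σ ∘ suc))

det≡detL : ∀ {n m} (R : Fin m → Fin n → ℤ) (σ : Fin m → Fin n) →
           det (λ i j → R i (σ j)) ≡ detL (tabulate R) (tabulate σ)
det≡detL {m = zero}  R σ = refl
det≡detL {m = suc m} R σ =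
  trans (altSum-cong (λ j → cong (R zero (σ j) *_) (det≡detL (R ∘ suc) (σ ∘ punchIn j))))
        (sym (expand-tabulate (R zero) (detL (tabulate (R ∘ suc))) σ))

altSign : ∀ {k} → Fin k → ℤ
altSign zero    = + 1
altSign (suc i) = - altSign i

altSum≡sumℤ : ∀ {k} (f : Fin k → ℤ) → altSum f ≡ sumℤ (λ i → altSign i * f i)
altSum≡sumℤ {zero}  f = refl
altSum≡sumℤ {suc k} f = cong₂ _+_ (sym (ℤ.*-identityˡ (f zero))) (begin
  - altSum (f ∘ suc)                         ≡⟨ cong -_ (altSum≡sumℤ (f ∘ suc)) ⟩
  - sumℤ (λ i → altSign i * f (suc i))       ≡⟨ sumℤ-neg (λ i → altSign i * f (suc i)) ⟨
  sumℤ (λ i → - (altSign i * f (suc i)))     ≡⟨ sumℤ-cong {k} (λ i → ℤ.neg-distribˡ-* (altSign i) _) ⟩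
  sumℤ (λ i → - altSign i * f (suc i))       ∎)
  where open ≡-Reasoning

∣altSign*∣ : ∀ {k} (i : Fin k) t → ∣ altSign i * t ∣ ≡ ∣ t ∣
∣altSign*∣ zero    t = cong ∣_∣ (ℤ.*-identityˡ t)
∣altSign*∣ (suc i) t = begin
  ∣ - altSign i * t ∣    ≡⟨ cong ∣_∣ (ℤ.neg-distribˡ-* (altSign i) t) ⟨
  ∣ - (altSign i * t) ∣  ≡⟨ ℤ.∣-i∣≡∣i∣ (altSign i * t) ⟩
  ∣ altSign i * t ∣      ≡⟨ ∣altSign*∣ i t ⟩
  ∣ t ∣                  ∎
  where open ≡-Reasoning

altSum-zero : ∀ {k} (f : Fin k → ℤ) → (∀ i → f i ≡ + 0) → altSum f ≡ + 0
altSum-zero {zero}  f f≗0 = refl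
altSum-zero {suc k} f f≗0 rewrite f≗0 zero | altSum-zero (f ∘ suc) (f≗0 ∘ suc) = refl

altSum-single : ∀ {k} (f : Fin k → ℤ) j → (∀ i → i ≢ j → f i ≡ + 0) → ∣ altSum f ∣ ≡ ∣ f j ∣
altSum-single f j f≗0 = begin
  ∣ altSum f ∣
    ≡⟨ cong ∣_∣ (altSum≡sumℤ f) ⟩
  ∣ sumℤ (λ i → altSign i * f i) ∣
    ≡⟨ cong ∣_∣ (sumℤ-single _ j (λ i i≢j → j≡0⇒i*j≡0 (altSign i) (f≗0 i i≢j))) ⟩
  ∣ altSign j * f j ∣
    ≡⟨ ∣altSign*∣ j (f j) ⟩
  ∣ f j ∣ ∎
  where open ≡-Reasoning

-- Gaussian elimination

module Pivot {p q : ℕ} (M : Matrix (suc p) (suc q)) (j : Fin (suc q)) where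

  pivot : ℤ
  pivot = M zero j

  combine : (Fin (suc q) → ℤ) → Fin (suc q) → ℤ
  combine ρ c = pivot * ρ c + (- ρ j) * M zero c

  eliminate : Matrix p q
  eliminate r l = combine (M (suc r)) (punchIn j l)

  -- The pivot coordinate of lift x is chosen so that the pivot row vanishes on it.
  lift : (Fin q → ℤ) → Fin (suc q) → ℤ
  lift x = insertAt (λ l → pivot * x l) j (- ((M zero ∘ punchIn j) ⋅ x))

  combine-j : ∀ ρ → combine ρ j ≡ + 0
  combine-j ρ = lemma pivot (ρ j)
    where lemma : ∀ a r → a * r + (- r) * a ≡ + 0
          lemma = solve-∀

  ⋅-lift : ∀ ρ x → ρ ⋅ lift x ≡ (combine ρ ∘ punchIn j) ⋅ x
  ⋅-lift ρ x = begin
    ρ ⋅ lift x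
      ≡⟨ sumℤ-remove (λ c → ρ c * lift x c) j ⟩
    ρ j * lift x j + sumℤ (λ l → ρ (punchIn j l) * lift x (punchIn j l))
      ≡⟨ cong₂ (λ u v → ρ j * u + v) (insertAt-lookup (λ l → pivot * x l) j _)
               (sumℤ-cong (λ l → cong (ρ (punchIn j l) *_) (insertAt-punchIn (λ l → pivot * x l) j _ l))) ⟩
    ρ j * - S + sumℤ (λ l → ρ (punchIn j l) * (pivot * x l))
      ≡⟨ cong (λ t → ρ j * - S + t) (trans (*-distribˡ-sumℤ pivot (λ l → ρ (punchIn j l) * x l))
                                            (sumℤ-cong (λ l → sym (lemma₁ (ρ (punchIn j l)) pivot (x l))))) ⟨
    ρ j * - S + pivot * ((ρ ∘ punchIn j) ⋅ x)
      ≡⟨ lemma₂ (ρ j) S pivot _ ⟩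
    pivot * ((ρ ∘ punchIn j) ⋅ x) + (- ρ j) * S
      ≡⟨ ⋅-linear pivot (- ρ j) (ρ ∘ punchIn j) (M zero ∘ punchIn j) x ⟨
    (combine ρ ∘ punchIn j) ⋅ x ∎
    where
    open ≡-Reasoning
    S = (M zero ∘ punchIn j) ⋅ x
    lemma₁ : ∀ r a x → r * (a * x) ≡ a * (r * x)
    lemma₁ = solve-∀
    lemma₂ : ∀ r s a t → r * - s + a * t ≡ a * t + (- r) * s
    lemma₂ = solve-∀

  ⋅-restrict : ∀ ρ x → (combine ρ ∘ punchIn j) ⋅ (x ∘ punchIn j) ≡ pivot * (ρ ⋅ x) + (- ρ j) * (M zero ⋅ x)
  ⋅-restrict ρ x = begin
    (combine ρ ∘ punchIn j) ⋅ (x ∘ punchIn j)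
      ≡⟨ ℤ.+-identityˡ _ ⟨
    + 0 + (combine ρ ∘ punchIn j) ⋅ (x ∘ punchIn j)
      ≡⟨ cong (λ t → t + (combine ρ ∘ punchIn j) ⋅ (x ∘ punchIn j)) (i≡0⇒i*j≡0 (x j) (combine-j ρ)) ⟨
    combine ρ j * x j + (combine ρ ∘ punchIn j) ⋅ (x ∘ punchIn j)
      ≡⟨ sumℤ-remove (λ c → combine ρ c * x c) j ⟨
    combine ρ ⋅ x
      ≡⟨ ⋅-linear pivot (- ρ j) ρ (M zero) x ⟩
    pivot * (ρ ⋅ x) + (- ρ j) * (M zero ⋅ x) ∎
    where open ≡-Reasoning

  lift-kernel : ∀ x → InL eliminate x → InL M (lift x)
  lift-kernel x ker zero    = trans (⋅-lift (M zero) x) (sumℤ-zero _ (λ l → lemma pivot (M zero (punchIn j l)) (x l)))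
    where lemma : ∀ a m x → (a * m + (- a) * m) * x ≡ + 0
          lemma = solve-∀
  lift-kernel x ker (suc r) = trans (⋅-lift (M (suc r)) x) (ker r)

  lift-nonzero : pivot ≢ + 0 → ∀ x → ¬ IsZero x → ¬ IsZero (lift x)
  lift-nonzero pivot≢0 x x≢0 lift≡0 =
    x≢0 (λ l → i*j≡0⇒j≡0 pivot≢0 (trans (sym (insertAt-punchIn (λ l → pivot * x l) j _ l)) (lift≡0 (punchIn j l))))

  restrict-kernel : ∀ x → InL M x → InL eliminate (x ∘ punchIn j)
  restrict-kernel x ker r = begin
    (combine (M (suc r)) ∘ punchIn j) ⋅ (x ∘ punchIn j)
      ≡⟨ ⋅-restrict (M (suc r)) x ⟩
    pivot * (M (suc r) ⋅ x) + (- M (suc r) j) * (M zero ⋅ x)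
      ≡⟨ cong₂ (λ u v → pivot * u + (- M (suc r) j) * v) (ker (suc r)) (ker zero) ⟩
    pivot * + 0 + (- M (suc r) j) * + 0
      ≡⟨ 0≡a*0+b*0 pivot (- M (suc r) j) ⟨
    + 0 ∎
    where open ≡-Reasoning

  restrict-nonzero : pivot ≢ + 0 → ∀ x → InL M x → ¬ IsZero x → ¬ IsZero (x ∘ punchIn j)
  restrict-nonzero pivot≢0 x ker x≢0 x∘punchIn≡0 = x≢0 x≡0
    where
    xj≡0 : x j ≡ + 0
    xj≡0 = i*j≡0⇒j≡0 pivot≢0 (begin
      pivot * x j
        ≡⟨ ℤ.+-identityʳ _ ⟨
      pivot * x j + + 0
        ≡⟨ cong (λ t → pivot * x j + t)
                (sumℤ-zero _ (λ l → j≡0⇒i*j≡0 (M zero (punchIn j l)) (x∘punchIn≡0 l))) ⟨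
      pivot * x j + (M zero ∘ punchIn j) ⋅ (x ∘ punchIn j)
        ≡⟨ sumℤ-remove (λ c → M zero c * x c) j ⟨
      M zero ⋅ x
        ≡⟨ ker zero ⟩
      + 0 ∎)
      where open ≡-Reasoning
    x≡0 : IsZero x
    x≡0 m with j Fin.≟ m
    ... | yes refl = xj≡0
    ... | no j≢m   = trans (cong x (sym (Fin.punchIn-punchOut j≢m))) (x∘punchIn≡0 (punchOut j≢m))

module _ {k : ℕ} (M : Matrix (suc k) (suc k)) (j : Fin (suc k)) where
  open Pivot M j

  det-eliminate : ∣ pivot ^ k * det M ∣ ≡ ∣ pivot * det eliminate ∣
  det-eliminate = begin
    ∣ pivot ^ k * det M ∣      ≡⟨ cong ∣_∣ reduced≡ ⟨
    ∣ det reduced ∣            ≡⟨ altSum-single _ j off-pivot ⟩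
    ∣ pivot * det eliminate ∣  ∎
    where
    open ≡-Reasoning
    reduced : Matrix (suc k) (suc k)
    reduced zero    = M zero
    reduced (suc r) = combine (M (suc r))
    reduced≡ : det reduced ≡ pivot ^ k * det M
    reduced≡ = begin
      det reduced
        ≡⟨ det≡detL reduced id ⟩
      detL (M zero ∷ tabulate (combine ∘ M ∘ suc)) (tabulate id)
        ≡⟨ cong (λ rs → detL (M zero ∷ rs) (tabulate id)) (List.map-tabulate (M ∘ suc) combine) ⟨
      detL (M zero ∷ [] ++ map combine (tabulate (M ∘ suc))) (tabulate id)
        ≡⟨ detL-eliminate (M zero) pivot (λ ρ → - ρ j) [] (tabulate (M ∘ suc)) (tabulate id) ⟩
      pivot ^ length (tabulate (M ∘ suc)) * detL (tabulate M) (tabulate id)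
        ≡⟨ cong₂ (λ u v → pivot ^ u * v) (List.length-tabulate (M ∘ suc)) (sym (det≡detL M id)) ⟩
      pivot ^ k * det M ∎
    off-pivot : ∀ c → c ≢ j → M zero c * det (λ r l → combine (M (suc r)) (punchIn c l)) ≡ + 0
    off-pivot c c≢j = j≡0⇒i*j≡0 (M zero c) minor≡0
      where
      j∈columns : j ∈ₗ tabulate (punchIn c)
      j∈columns = subst (_∈ₗ tabulate (punchIn c)) (Fin.punchIn-punchOut c≢j) (∈-tabulate⁺ (punchOut c≢j))
      minor≡0 : det (λ r l → combine (M (suc r)) (punchIn c l)) ≡ + 0
      minor≡0 = trans (det≡detL (combine ∘ M ∘ suc) (punchIn c))
                      (detL-zero-column j _ (All.tabulate⁺ (combine-j ∘ M ∘ suc)) (tabulate (punchIn c)) j∈columns)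

  det≡0⇒det-eliminate≡0 : pivot ≢ + 0 → det M ≡ + 0 → det eliminate ≡ + 0
  det≡0⇒det-eliminate≡0 pivot≢0 detM≡0 = i*j≡0⇒j≡0 pivot≢0 (ℤ.∣i∣≡0⇒i≡0
    (trans (sym det-eliminate) (cong ∣_∣ (j≡0⇒i*j≡0 (pivot ^ k) detM≡0))))

  det-eliminate≡0⇒det≡0 : pivot ≢ + 0 → det eliminate ≡ + 0 → det M ≡ + 0
  det-eliminate≡0⇒det≡0 pivot≢0 det-elim≡0 =
    i*j≡0⇒j≡0 (pivot≢0 ∘ ℤ.i^n≡0⇒i≡0 pivot k) (ℤ.∣i∣≡0⇒i≡0
    (trans det-eliminate (cong ∣_∣ (j≡0⇒i*j≡0 pivot det-elim≡0))))

zero-row-kernel : ∀ {p q} (M : Matrix (suc p) q) x → (∀ c → M zero c ≡ + 0) → InL (M ∘ suc) x → InL M x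
zero-row-kernel M x row≡0 ker zero    = sumℤ-zero _ (λ c → i≡0⇒i*j≡0 (x c) (row≡0 c))
zero-row-kernel M x row≡0 ker (suc r) = ker r

wide-kernel : ∀ {p q} (N : Matrix p q) → p ℕ.< q → ∃[ x ] ¬ IsZero x × InL N x
wide-kernel {zero}  {suc q} N _ = e₀ , (λ e₀≡0 → contradiction (e₀≡0 zero) λ ()) , λ ()
  where e₀ : Fin (suc q) → ℤ
        e₀ zero    = + 1
        e₀ (suc _) = + 0
wide-kernel {suc p} {suc q} N (s≤s p<q) with nonzero-entry? (N zero)
... | inj₁ row≡0 with x , x≢0 , ker ← wide-kernel (N ∘ suc) (ℕ.m<n⇒m<1+n p<q)
  = x , x≢0 , zero-row-kernel N x row≡0 ker
... | inj₂ (j , pivot≢0) with x , x≢0 , ker ← wide-kernel (Pivot.eliminate N j) p<q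
  = Pivot.lift N j x , Pivot.lift-nonzero N j pivot≢0 x x≢0 , Pivot.lift-kernel N j x ker

det≡0⇒kernel : ∀ {k} (M : Matrix k k) → det M ≡ + 0 → ∃[ x ] ¬ IsZero x × InL M x
det≡0⇒kernel {zero}  M ()
det≡0⇒kernel {suc k} M detM≡0 with nonzero-entry? (M zero)
... | inj₁ row≡0 with x , x≢0 , ker ← wide-kernel (M ∘ suc) (ℕ.n<1+n k)
  = x , x≢0 , zero-row-kernel M x row≡0 ker
... | inj₂ (j , pivot≢0)
  with x , x≢0 , ker ← det≡0⇒kernel (Pivot.eliminate M j) (det≡0⇒det-eliminate≡0 M j pivot≢0 detM≡0)
  = Pivot.lift M j x , Pivot.lift-nonzero M j pivot≢0 x x≢0 , Pivot.lift-kernel M j x ker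

kernel⇒det≡0 : ∀ {k} (M : Matrix k k) x → ¬ IsZero x → InL M x → det M ≡ + 0
kernel⇒det≡0 {zero}  M x x≢0 ker = contradiction (λ ()) x≢0
kernel⇒det≡0 {suc k} M x x≢0 ker with nonzero-entry? (M zero)
... | inj₁ row≡0 = altSum-zero _ (λ c → i≡0⇒i*j≡0 (firstRowMinor c) (row≡0 c))
  where firstRowMinor : Fin (suc k) → ℤ
        firstRowMinor c = det (λ r l → M (suc r) (punchIn c l))
... | inj₂ (j , pivot≢0) = det-eliminate≡0⇒det≡0 M j pivot≢0
  (kernel⇒det≡0 (Pivot.eliminate M j) (x ∘ punchIn j)
     (Pivot.restrict-nonzero M j pivot≢0 x ker x≢0) (Pivot.restrict-kernel M j x ker))

-- Column submatrices and Cramer's rule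

δ : ∀ {n} → Fin n → Fin n → ℤ
δ a b with a Fin.≟ b
... | yes _ = + 1
... | no  _ = + 0

δ-refl : ∀ {n} (a : Fin n) → δ a a ≡ + 1
δ-refl a with a Fin.≟ a
... | yes _   = refl
... | no  a≢a = contradiction refl a≢a

δ-≢ : ∀ {n} {a b : Fin n} → a ≢ b → δ a b ≡ + 0
δ-≢ {a = a} {b} a≢b with a Fin.≟ b
... | yes a≡b = contradiction a≡b a≢b
... | no  _   = refl

sumℤ-δ : ∀ {n} (a : Fin n) (f : Fin n → ℤ) → sumℤ (λ m → δ a m * f m) ≡ f a
sumℤ-δ a f = begin
  sumℤ (λ m → δ a m * f m)  ≡⟨ sumℤ-single _ a (λ m m≢a → i≡0⇒i*j≡0 (f m) (δ-≢ (m≢a ∘ sym))) ⟩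
  δ a a * f a               ≡⟨ cong (_* f a) (δ-refl a) ⟩
  + 1 * f a                 ≡⟨ ℤ.*-identityˡ (f a) ⟩
  f a                       ∎
  where open ≡-Reasoning

Image : ∀ {k n} → (Fin k → Fin n) → Fin n → Set
Image σ m = ∃[ l ] σ l ≡ m

SupportedIn : ∀ {n} → (Fin n → Set) → (Fin n → ℤ) → Set
SupportedIn P c = ∀ m → ¬ P m → c m ≡ + 0

push : ∀ {k n} → (Fin k → Fin n) → (Fin k → ℤ) → Fin n → ℤ
push σ x m = sumℤ (λ l → δ (σ l) m * x l)

module _ {k n : ℕ} (σ : Fin k → Fin n) where

  ⋅-push : ∀ ρ x → ρ ⋅ push σ x ≡ (ρ ∘ σ) ⋅ x
  ⋅-push ρ x = begin
    sumℤ (λ m → ρ m * sumℤ (λ l → δ (σ l) m * x l))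
      ≡⟨ sumℤ-cong (λ m → *-distribˡ-sumℤ (ρ m) (λ l → δ (σ l) m * x l)) ⟩
    sumℤ (λ m → sumℤ (λ l → ρ m * (δ (σ l) m * x l)))
      ≡⟨ sumℤ-comm (λ m l → ρ m * (δ (σ l) m * x l)) ⟩
    sumℤ (λ l → sumℤ (λ m → ρ m * (δ (σ l) m * x l)))
      ≡⟨ sumℤ-cong (λ l → sumℤ-cong (λ m → lemma (ρ m) (δ (σ l) m) (x l))) ⟩
    sumℤ (λ l → sumℤ (λ m → δ (σ l) m * ρ m * x l))
      ≡⟨ sumℤ-cong (λ l → *-distribʳ-sumℤ (x l) (λ m → δ (σ l) m * ρ m)) ⟨
    sumℤ (λ l → sumℤ (λ m → δ (σ l) m * ρ m) * x l)
      ≡⟨ sumℤ-cong (λ l → cong (_* x l) (sumℤ-δ (σ l) ρ)) ⟩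
    sumℤ (λ l → ρ (σ l) * x l) ∎
    where
    open ≡-Reasoning
    lemma : ∀ r d x → r * (d * x) ≡ d * r * x
    lemma = solve-∀

  push-outside : ∀ x m → ¬ Image σ m → push σ x m ≡ + 0
  push-outside x m m∉σ = sumℤ-zero _ (λ l → i≡0⇒i*j≡0 (x l) (δ-≢ (m∉σ ∘ (l ,_))))

  push-at : Injective _≡_ _≡_ σ → ∀ x l → push σ x (σ l) ≡ x l
  push-at σ-inj x l = begin
    sumℤ (λ l′ → δ (σ l′) (σ l) * x l′)
      ≡⟨ sumℤ-single _ l (λ l′ l′≢l → i≡0⇒i*j≡0 (x l′) (δ-≢ (l′≢l ∘ σ-inj))) ⟩
    δ (σ l) (σ l) * x l
      ≡⟨ cong (_* x l) (δ-refl (σ l)) ⟩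
    + 1 * x l
      ≡⟨ ℤ.*-identityˡ (x l) ⟩
    x l ∎
    where open ≡-Reasoning

  push-restrict : Injective _≡_ _≡_ σ → ∀ c → SupportedIn (Image σ) c → ∀ m → push σ (c ∘ σ) m ≡ c m
  push-restrict σ-inj c c-supp m with Fin.any? (λ l → σ l Fin.≟ m)
  ... | yes (l , refl) = push-at σ-inj (c ∘ σ) l
  ... | no  m∉σ        = trans (push-outside (c ∘ σ) m m∉σ) (sym (c-supp m m∉σ))

columns : ∀ {d n k} → Matrix d n → (Fin k → Fin n) → Matrix d k
columns A σ i l = A i (σ l)

Dependent : ∀ {d n} → Matrix d n → (Fin n → Set) → Set
Dependent A P = ∃[ c ] InL A c × ¬ IsZero c × SupportedIn P c

module _ {d n k : ℕ} (A : Matrix d n) {σ : Fin k → Fin n} (σ-inj : Injective _≡_ _≡_ σ) where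

  push-dependent : ∀ x → ¬ IsZero x → InL (columns A σ) x → Dependent A (Image σ)
  push-dependent x x≢0 ker =
    push σ x ,
    (λ i → trans (⋅-push σ (A i) x) (ker i)) ,
    (λ push≡0 → x≢0 (λ l → trans (sym (push-at σ σ-inj x l)) (push≡0 (σ l)))) ,
    push-outside σ x

  columns-kernel : ∀ c → InL A c → SupportedIn (Image σ) c → InL (columns A σ) (c ∘ σ)
  columns-kernel c ker c-supp i = begin
    (A i ∘ σ) ⋅ (c ∘ σ)  ≡⟨ ⋅-push σ (A i) (c ∘ σ) ⟨
    A i ⋅ push σ (c ∘ σ) ≡⟨ sumℤ-cong (λ m → cong (A i m *_) (push-restrict σ σ-inj c c-supp m)) ⟩
    A i ⋅ c              ≡⟨ ker i ⟩
    + 0                  ∎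
    where open ≡-Reasoning

  columns-nonzero : ∀ c → ¬ IsZero c → SupportedIn (Image σ) c → ¬ IsZero (c ∘ σ)
  columns-nonzero c c≢0 c-supp c∘σ≡0 = c≢0 (λ m → begin
    c m                  ≡⟨ push-restrict σ σ-inj c c-supp m ⟨
    push σ (c ∘ σ) m     ≡⟨ sumℤ-zero _ (λ l → j≡0⇒i*j≡0 (δ (σ l) m) (c∘σ≡0 l)) ⟩
    + 0                  ∎)
    where open ≡-Reasoning

  wide-dependent : d ℕ.< k → Dependent A (Image σ)
  wide-dependent d<k with x , x≢0 , ker ← wide-kernel (columns A σ) d<k = push-dependent x x≢0 ker

module _ {d n : ℕ} (A : Matrix d n) {σ : Fin d → Fin n} (σ-inj : Injective _≡_ _≡_ σ) where

  minor≡0⇒dependent : minor A σ ≡ + 0 → Dependent A (Image σ)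
  minor≡0⇒dependent minor≡0 with x , x≢0 , ker ← det≡0⇒kernel (columns A σ) minor≡0 =
    push-dependent A σ-inj x x≢0 ker

  dependent⇒minor≡0 : Dependent A (Image σ) → minor A σ ≡ + 0
  dependent⇒minor≡0 (c , ker , c≢0 , c-supp) =
    kernel⇒det≡0 (columns A σ) (c ∘ σ) (columns-nonzero A σ-inj c c≢0 c-supp) (columns-kernel A σ-inj c ker c-supp)

module _ {d n : ℕ} (A : Matrix d n) (σ : Fin (suc d) → Fin n) where

  -- Cramer's rule: the signed maximal minors of d + 1 columns give a kernel vector.
  signedMinor : Fin (suc d) → ℤ
  signedMinor l = altSign l * minor A (σ ∘ punchIn l)

  cramer : Fin n → ℤ
  cramer = push σ signedMinor

  cramer-kernel : InL A cramer
  cramer-kernel r with M , Q , tabulate≡ ← ∈-∃++ (∈-tabulate⁺ {f = A} r) = begin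
    A r ⋅ cramer
      ≡⟨ ⋅-push σ (A r) signedMinor ⟩
    sumℤ (λ l → A r (σ l) * (altSign l * minor A (σ ∘ punchIn l)))
      ≡⟨ sumℤ-cong (λ l → lemma (A r (σ l)) (altSign l) (minor A (σ ∘ punchIn l))) ⟩
    sumℤ (λ l → altSign l * (A r (σ l) * minor A (σ ∘ punchIn l)))
      ≡⟨ altSum≡sumℤ (λ l → A r (σ l) * minor A (σ ∘ punchIn l)) ⟨
    det (λ i l → stacked i (σ l))
      ≡⟨ det≡detL stacked σ ⟩
    detL (A r ∷ tabulate A) (tabulate σ)
      ≡⟨ cong (λ rs → detL (A r ∷ rs) (tabulate σ)) tabulate≡ ⟩
    detL (A r ∷ M ++ A r ∷ Q) (tabulate σ)
      ≡⟨ detL-repeated-row [] (A r) M Q (tabulate σ) ⟩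
    + 0 ∎
    where
    open ≡-Reasoning
    stacked : Matrix (suc d) n
    stacked zero    = A r
    stacked (suc i) = A i
    lemma : ∀ a s m → a * (s * m) ≡ s * (a * m)
    lemma = solve-∀

  cramer-at : Injective _≡_ _≡_ σ → ∀ l → cramer (σ l) ≡ altSign l * minor A (σ ∘ punchIn l)
  cramer-at σ-inj = push-at σ σ-inj signedMinor

  cramer-supported : SupportedIn (Image σ) cramer
  cramer-supported = push-outside σ signedMinor

-- Subsets and increasing enumerations

subset : ∀ {n} {P : Fin n → Set} → Decidable P → Subset n
subset P? = Vec.tabulate (does ∘ P?)

∈-subset⁺ : ∀ {n} {P : Fin n → Set} (P? : Decidable P) {m} → P m → m ∈ subset P?
∈-subset⁺ P? {m} Pm = Vec.lookup⇒[]= m _ (trans (Vec.lookup∘tabulate _ m) (dec-true (P? m) Pm))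

∈-subset⁻ : ∀ {n} {P : Fin n → Set} (P? : Decidable P) {m} → m ∈ subset P? → P m
∈-subset⁻ P? {m} m∈ with P? m | trans (sym (Vec.lookup∘tabulate (does ∘ P?) m)) (Vec.[]=⇒lookup m∈)
... | yes Pm | _ = Pm

elements : ∀ {n} → Subset n → List (Fin n)
elements p = filter (_∈? p) (allFin _)

elements-sorted : ∀ {n} (p : Subset n) → AllPairs Fin._<_ (elements p)
elements-sorted p = AllPairs.filter⁺ (_∈? p) (AllPairs.tabulate⁺-< id)

∈-elements⁺ : ∀ {n} {p : Subset n} {m} → m ∈ p → m ∈ₗ elements p
∈-elements⁺ {p = p} {m} m∈p = ∈-filter⁺ (_∈? p) (∈-allFin m) m∈p

∈-elements⁻ : ∀ {n} {p : Subset n} {m} → m ∈ₗ elements p → m ∈ p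
∈-elements⁻ {n} {p} = proj₂ ∘ ∈-filter⁻ (_∈? p) {xs = allFin n}

module _ {n : ℕ} {p : Subset n} {j : Fin n} where

  private
    filter-∪⁅⁆ : ∀ {xs} → All (j ≢_) xs → filter (_∈? p ∪ ⁅ j ⁆) xs ≡ filter (_∈? p) xs
    filter-∪⁅⁆ [] = refl
    filter-∪⁅⁆ {x ∷ xs} (j≢x ∷ j∉xs) with x ∈? p ∪ ⁅ j ⁆ | x ∈? p
    ... | yes _   | yes _   = cong (x ∷_) (filter-∪⁅⁆ j∉xs)
    ... | no _    | no _    = filter-∪⁅⁆ j∉xs
    ... | no x∉   | yes x∈p = contradiction (p⊆p∪q ⁅ j ⁆ x∈p) x∉
    ... | yes x∈  | no x∉p with x∈p∪q⁻ p ⁅ j ⁆ x∈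
    ...   | inj₁ x∈p = contradiction x∈p x∉p
    ...   | inj₂ x∈j = contradiction (sym (x∈⁅y⁆⇒x≡y j x∈j)) j≢x

    length-filter-∪⁅⁆ : ∀ {xs} → AllPairs Fin._<_ xs → j ∈ₗ xs → j ∉ p →
                        length (filter (_∈? p ∪ ⁅ j ⁆) xs) ≡ suc (length (filter (_∈? p) xs))
    length-filter-∪⁅⁆ {x ∷ xs} (x<xs ∷ _) (here refl) j∉p with j ∈? p ∪ ⁅ j ⁆ | j ∈? p
    ... | yes _  | no _   = cong (suc ∘ length) (filter-∪⁅⁆ (All.map Fin.<⇒≢ x<xs))
    ... | _      | yes j∈p = contradiction j∈p j∉p
    ... | no j∉  | _       = contradiction (q⊆p∪q p ⁅ j ⁆ (x∈⁅x⁆ j)) j∉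
    length-filter-∪⁅⁆ {x ∷ xs} (x<xs ∷ sorted) (there j∈xs) j∉p
      with x ∈? p ∪ ⁅ j ⁆ | x ∈? p | length-filter-∪⁅⁆ sorted j∈xs j∉p
    ... | yes _  | yes _   | ih = cong suc ih
    ... | no _   | no _    | ih = ih
    ... | no x∉  | yes x∈p | _  = contradiction (p⊆p∪q ⁅ j ⁆ x∈p) x∉
    ... | yes x∈ | no x∉p  | _ with x∈p∪q⁻ p ⁅ j ⁆ x∈
    ...   | inj₁ x∈p = contradiction x∈p x∉p
    ...   | inj₂ x∈j = contradiction (x∈⁅y⁆⇒x≡y j x∈j) (Fin.<⇒≢ (All.lookup x<xs j∈xs))

  length-elements-∪⁅⁆ : j ∉ p → length (elements (p ∪ ⁅ j ⁆)) ≡ suc (length (elements p))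
  length-elements-∪⁅⁆ = length-filter-∪⁅⁆ (AllPairs.tabulate⁺-< id) (∈-allFin j)

lookup-increasing : ∀ {n} {ℓ : List (Fin n)} → AllPairs Fin._<_ ℓ → Increasing (lookup ℓ)
lookup-increasing (x<ℓ ∷ _)      zero    (suc j) _         = All.lookup x<ℓ (∈-lookup j)
lookup-increasing (_ ∷ sorted)   (suc i) (suc j) (s≤s i<j) = lookup-increasing sorted i j i<j

increasing⇒injective : ∀ {k n} {σ : Fin k → Fin n} → Increasing σ → Injective _≡_ _≡_ σ
increasing⇒injective {σ = σ} σ-inc {i} {j} σi≡σj with Fin.<-cmp i j
... | tri< i<j _ _ = contradiction σi≡σj (Fin.<⇒≢ (σ-inc i j i<j))
... | tri≈ _ i≡j _ = i≡j
... | tri> _ _ j<i = contradiction (sym σi≡σj) (Fin.<⇒≢ (σ-inc j i j<i))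

Image-lookup⁻ : ∀ {n} {ℓ : List (Fin n)} {m} → Image (lookup ℓ) m → m ∈ₗ ℓ
Image-lookup⁻ (i , refl) = ∈-lookup i

Image-lookup⁺ : ∀ {n} {ℓ : List (Fin n)} {m} → m ∈ₗ ℓ → Image (lookup ℓ) m
Image-lookup⁺ m∈ℓ = index m∈ℓ , sym (lookup-index m∈ℓ)

record Enumeration {n} (P : Fin n → Set) (k : ℕ) : Set where
  field
    σ          : Fin k → Fin n
    increasing : Increasing σ
    image⁺     : ∀ {m} → P m → Image σ m
    image⁻     : ∀ {m} → Image σ m → P m

  injective : Injective _≡_ _≡_ σ
  injective = increasing⇒injective increasing

enumerate : ∀ {n k} (p : Subset n) → length (elements p) ≡ k → Enumeration (_∈ p) k
enumerate p refl = record
  { σ          = lookup (elements p)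
  ; increasing = lookup-increasing (elements-sorted p)
  ; image⁺     = Image-lookup⁺ ∘ ∈-elements⁺
  ; image⁻     = ∈-elements⁻ ∘ Image-lookup⁻
  }

punchIn-increasing : ∀ {k} (l : Fin (suc k)) → Increasing (punchIn l)
punchIn-increasing zero    i       j       i<j       = s≤s i<j
punchIn-increasing (suc l) zero    (suc j) _         = s≤s z≤n
punchIn-increasing (suc l) (suc i) (suc j) (s≤s i<j) = s≤s (punchIn-increasing l i j i<j)

∘-increasing : ∀ {k l n} {σ : Fin l → Fin n} {τ : Fin k → Fin l} →
               Increasing σ → Increasing τ → Increasing (σ ∘ τ)
∘-increasing σ-inc τ-inc i j i<j = σ-inc _ _ (τ-inc i j i<j)

-- The matroid of A

support : ∀ {n} → (Fin n → ℤ) → Subset n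
support c = subset (λ m → ¬? (c m ℤ.≟ + 0))

∈-support⁺ : ∀ {n} {c : Fin n → ℤ} {m} → c m ≢ + 0 → m ∈ support c
∈-support⁺ {c = c} = ∈-subset⁺ (λ m → ¬? (c m ℤ.≟ + 0))

∈-support⁻ : ∀ {n} {c : Fin n → ℤ} {m} → m ∈ support c → c m ≢ + 0
∈-support⁻ {c = c} = ∈-subset⁻ (λ m → ¬? (c m ℤ.≟ + 0))

supported⇒support⊆ : ∀ {n} {F : Subset n} {c} → SupportedIn (_∈ F) c → support c ⊆ F
supported⇒support⊆ {F = F} {c} c-supp {m} m∈supp with m ∈? F
... | yes m∈F = m∈F
... | no  m∉F = contradiction (c-supp m m∉F) (∈-support⁻ {c = c} m∈supp)

support⊆⇒supported : ∀ {n} {F : Subset n} {c} → support c ⊆ F → SupportedIn (_∈ F) c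
support⊆⇒supported {c = c} supp⊆F m m∉F =
  decidable-stable (c m ℤ.≟ + 0) (λ cm≢0 → m∉F (supp⊆F (∈-support⁺ {c = c} cm≢0)))

support-⊆ : ∀ {n} {c c′ : Fin n → ℤ} → (∀ m → c m ≡ + 0 → c′ m ≡ + 0) → support c′ ⊆ support c
support-⊆ {c = c} {c′} c≡0⇒c′≡0 {m} m∈c′ =
  ∈-support⁺ {c = c} (∈-support⁻ {c = c′} m∈c′ ∘ c≡0⇒c′≡0 m)

module _ {d n : ℕ} (A : Matrix d n) where

  independent⇒¬dependent : ∀ {F} → Independent A F → ¬ Dependent A (_∈ F)
  independent⇒¬dependent F-ind (c , ker , c≢0 , c-supp) = c≢0 (F-ind c c-supp ker)

  ¬independent⇒dependent : ∀ {F} → ¬ Independent A F → ¬ ¬ Dependent A (_∈ F)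
  ¬independent⇒dependent ¬ind ¬dep =
    ¬ind (λ c c-supp ker → decidable-stable (IsZero? c) (λ c≢0 → ¬dep (c , ker , c≢0 , c-supp)))

  independent-⊆ : ∀ {F G} → F ⊆ G → Independent A G → Independent A F
  independent-⊆ F⊆G G-ind c c-supp = G-ind c (λ m m∉G → c-supp m (m∉G ∘ F⊆G))

  Circuit : (Fin n → ℤ) → Set
  Circuit c = InL A c × ¬ IsZero c ×
              (∀ c′ → InL A c′ → ¬ IsZero c′ → support c′ ⊆ support c → support c ⊆ support c′)

  private
    StrictlySmaller : (Fin n → ℤ) → Set
    StrictlySmaller c = ∃[ c′ ] InL A c′ × ¬ IsZero c′ × support c′ ⊂ support c

    ¬smaller⇒minimal : ∀ {c} → ¬ StrictlySmaller c →
                       ∀ c′ → InL A c′ → ¬ IsZero c′ → support c′ ⊆ support c → support c ⊆ support c′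
    ¬smaller⇒minimal no-smaller c′ ker′ c′≢0 c′⊆c {m} m∈c with m ∈? support c′
    ... | yes m∈c′ = m∈c′
    ... | no  m∉c′ = contradiction (c′ , ker′ , c′≢0 , (λ {x} → c′⊆c {x}) , m , m∈c , m∉c′) no-smaller

    circuit-below-acc : ∀ c → Acc _⊂_ (support c) → InL A c → ¬ IsZero c →
                        ¬ ¬ (∃[ c′ ] Circuit c′ × support c′ ⊆ support c)
    circuit-below-acc c (acc smaller) ker c≢0 = ¬¬-excluded-middle {A = StrictlySmaller c} >>= λ where
      (yes (c′ , ker′ , c′≢0 , c′⊂c)) → do
        (c″ , circuit , c″⊆c′) ← circuit-below-acc c′ (smaller c′⊂c) ker′ c′≢0
        pure (c″ , circuit , λ {x} x∈c″ → proj₁ c′⊂c (c″⊆c′ x∈c″))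
      (no no-smaller) → pure (c , (ker , c≢0 , ¬smaller⇒minimal {c} no-smaller) , λ {x} x∈c → x∈c)

  circuit-below : ∀ c → InL A c → ¬ IsZero c → ¬ ¬ (∃[ c′ ] Circuit c′ × support c′ ⊆ support c)
  circuit-below c = circuit-below-acc c (⊂-wellFounded (support c))

  dependent-mono : ∀ {P Q : Fin n → Set} → (∀ {m} → P m → Q m) → Dependent A P → Dependent A Q
  dependent-mono P⇒Q (c , ker , c≢0 , c-supp) = c , ker , c≢0 , λ m ¬Qm → c-supp m (¬Qm ∘ P⇒Q)

  Maximal : Subset n → Set
  Maximal J = ∀ a → a ∈ J ⊎ ¬ Independent A (J ∪ ⁅ a ⁆)

  private
    ∪-monoˡ : ∀ {p q r : Subset n} → p ⊆ q → p ∪ r ⊆ q ∪ r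
    ∪-monoˡ {p} {q} {r} p⊆q x∈p∪r = x∈p∪q⁺ (Sum.map₁ p⊆q (x∈p∪q⁻ p r x∈p∪r))

    extend : ∀ (xs : List (Fin n)) {I} → Independent A I →
             ¬ ¬ (∃[ J ] I ⊆ J × Independent A J ×
                  (∀ {a} → a ∈ₗ xs → a ∈ J ⊎ ¬ Independent A (J ∪ ⁅ a ⁆)))
    extend []       {I} I-ind = pure (I , (λ {x} x∈I → x∈I) , I-ind , λ ())
    extend (a ∷ xs) {I} I-ind = ¬¬-excluded-middle {A = Independent A (I ∪ ⁅ a ⁆)} >>= λ where
      (yes Ia-ind) → do
        (J , Ia⊆J , J-ind , J-max) ← extend xs Ia-ind
        pure (J , (λ {x} x∈I → Ia⊆J (p⊆p∪q ⁅ a ⁆ x∈I)) , J-ind , λ where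
          (here refl)  → inj₁ (Ia⊆J (q⊆p∪q I ⁅ a ⁆ (x∈⁅x⁆ a)))
          (there a∈xs) → J-max a∈xs)
      (no ¬Ia-ind) → do
        (J , I⊆J , J-ind , J-max) ← extend xs I-ind
        pure (J , (λ {x} → I⊆J {x}) , J-ind , λ where
          (here refl)  → inj₂ (¬Ia-ind ∘ independent-⊆ (∪-monoˡ (λ {x} → I⊆J {x})))
          (there a∈xs) → J-max a∈xs)

  extend-to-basis : ∀ {I} → Independent A I → ¬ ¬ (∃[ J ] I ⊆ J × Independent A J × Maximal J)
  extend-to-basis I-ind = do
    (J , I⊆J , J-ind , J-max) ← extend (allFin n) I-ind
    pure (J , (λ {x} → I⊆J {x}) , J-ind , λ a → J-max (∈-allFin a))

  ⋅-transpose : ∀ (y : Fin d → ℤ) c → (λ m → sumℤ (λ r → y r * A r m)) ⋅ c ≡ y ⋅ (A · c)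
  ⋅-transpose y c = begin
    sumℤ (λ m → sumℤ (λ r → y r * A r m) * c m)
      ≡⟨ sumℤ-cong (λ m → *-distribʳ-sumℤ (c m) (λ r → y r * A r m)) ⟩
    sumℤ (λ m → sumℤ (λ r → y r * A r m * c m))
      ≡⟨ sumℤ-comm (λ m r → y r * A r m * c m) ⟩
    sumℤ (λ r → sumℤ (λ m → y r * A r m * c m))
      ≡⟨ sumℤ-cong (λ r → sumℤ-cong (λ m → ℤ.*-assoc (y r) (A r m) (c m))) ⟩
    sumℤ (λ r → sumℤ (λ m → y r * (A r m * c m)))
      ≡⟨ sumℤ-cong (λ r → *-distribˡ-sumℤ (y r) (λ m → A r m * c m)) ⟨
    sumℤ (λ r → y r * (A · c) r) ∎
    where open ≡-Reasoning

  -- Each column outside J completes J to a dependent set, whose kernel vector isolates that column.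
  vanishes-on-basis : ∀ {J} → Independent A J → Maximal J → (g : Fin n → ℤ) →
                      (∀ c → InL A c → g ⋅ c ≡ + 0) → (∀ {m} → m ∈ J → g m ≡ + 0) →
                      ∀ m → g m ≡ + 0
  vanishes-on-basis {J} J-ind J-max g g-ker g-J m with J-max m
  ... | inj₁ m∈J  = g-J m∈J
  ... | inj₂ ¬ind = decidable-stable (g m ℤ.≟ + 0) (do
    (c , ker , c≢0 , c-supp) ← ¬independent⇒dependent ¬ind
    pure (g-at-m c ker c≢0 c-supp))
    where
    ∉J∪m : ∀ {m′} → m′ ∉ J → m′ ≢ m → m′ ∉ J ∪ ⁅ m ⁆
    ∉J∪m m′∉J m′≢m = Sum.[ m′∉J , m′≢m ∘ x∈⁅y⁆⇒x≡y m ] ∘ x∈p∪q⁻ J ⁅ m ⁆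
    g-at-m : ∀ c → InL A c → ¬ IsZero c → SupportedIn (_∈ J ∪ ⁅ m ⁆) c → g m ≡ + 0
    g-at-m c ker c≢0 c-supp = i*j≡0⇒j≡0 cm≢0 (trans (ℤ.*-comm (c m) (g m)) (trans (sym g⋅c≡) (g-ker c ker)))
      where
      others : ∀ m′ → m′ ≢ m → g m′ * c m′ ≡ + 0
      others m′ m′≢m with m′ ∈? J
      ... | yes m′∈J = i≡0⇒i*j≡0 (c m′) (g-J m′∈J)
      ... | no  m′∉J = j≡0⇒i*j≡0 (g m′) (c-supp m′ (∉J∪m m′∉J m′≢m))
      g⋅c≡ : g ⋅ c ≡ g m * c m
      g⋅c≡ = sumℤ-single (λ m′ → g m′ * c m′) m others
      cm≢0 : c m ≢ + 0
      cm≢0 cm≡0 = independent⇒¬dependent J-ind (c , ker , c≢0 , c-off-J)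
        where
        c-off-J : ∀ m′ → m′ ∉ J → c m′ ≡ + 0
        c-off-J m′ m′∉J with m′ Fin.≟ m
        ... | yes refl  = cm≡0
        ... | no  m′≢m = c-supp m′ (∉J∪m m′∉J m′≢m)

  independent⇒length≤rank : ∀ {J} → Independent A J → length (elements J) ℕ.≤ d
  independent⇒length≤rank {J} J-ind = ℕ.≮⇒≥ λ d<ℓ →
    independent⇒¬dependent J-ind (dependent-mono (∈-elements⁻ ∘ Image-lookup⁻)
      (wide-dependent A (increasing⇒injective (lookup-increasing (elements-sorted J))) d<ℓ))

  rank≤length : RankFull A → ∀ {J} → Independent A J → Maximal J → d ℕ.≤ length (elements J)
  rank≤length full {J} J-ind J-max = ℕ.≮⇒≥ λ ℓ<d →
    let (y , y≢0 , y-ker) = wide-kernel (λ i r → A r (lookup (elements J) i)) ℓ<d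
    in  y≢0 (full y (vanishes-on-basis J-ind J-max (row-combination y)
                       (row-combination-ker y) (row-combination-J y y-ker)))
    where
    row-combination : (Fin d → ℤ) → Fin n → ℤ
    row-combination y m = sumℤ (λ r → y r * A r m)
    row-combination-ker : ∀ y c → InL A c → row-combination y ⋅ c ≡ + 0
    row-combination-ker y c ker =
      trans (⋅-transpose y c) (sumℤ-zero _ (λ r → j≡0⇒i*j≡0 (y r) (ker r)))
    row-combination-J : ∀ y → InL (λ i r → A r (lookup (elements J) i)) y →
                        ∀ {m} → m ∈ J → row-combination y m ≡ + 0
    row-combination-J y y-ker m∈J with i , refl ← Image-lookup⁺ (∈-elements⁺ m∈J) =
      trans (sumℤ-cong (λ r → ℤ.*-comm (y r) _)) (y-ker i)

  basis-size : RankFull A → ∀ {J} → Independent A J → Maximal J → length (elements J) ≡ d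
  basis-size full J-ind J-max = ℕ.≤-antisym (independent⇒length≤rank J-ind) (rank≤length full J-ind J-max)

-- Sign circuits

signum : ℤ → ℤ
signum (+ zero)   = + 0
signum (+ suc _)  = + 1
signum -[1+ _ ]   = - + 1

IsSign : ℤ → Set
IsSign t = t ≡ + 0 ⊎ t ≡ + 1 ⊎ t ≡ - + 1

signum-sign : ∀ t → IsSign (signum t)
signum-sign (+ zero)  = inj₁ refl
signum-sign (+ suc _) = inj₂ (inj₁ refl)
signum-sign -[1+ _ ]  = inj₂ (inj₂ refl)

signum≡0 : ∀ {t} → signum t ≡ + 0 → t ≡ + 0
signum≡0 {+ zero} _ = refl

abs*signum : ∀ t → + ∣ t ∣ * signum t ≡ t
abs*signum (+ zero)   = refl
abs*signum (+ suc k)  = ℤ.*-identityʳ (+ suc k)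
abs*signum -[1+ k ]   = trans (ℤ.*-comm (+ suc k) (- + 1)) (ℤ.-1*i≡-i (+ suc k))

SignVector : ∀ {n} → (Fin n → ℤ) → Set
SignVector x = ∀ m → IsSign (x m)

module _ {d n : ℕ} (A : Matrix d n) where

  -- z = ∣ z j ∣ · signum z.
  signum-kernel : ∀ z j → InL A z → z j ≢ + 0 → (∀ m → z m ≡ + 0 ⊎ ∣ z m ∣ ≡ ∣ z j ∣) →
                  InL A (signum ∘ z)
  signum-kernel z j ker zj≢0 z-flat r = i*j≡0⇒j≡0 D≢0 (begin
    D * (A r ⋅ (signum ∘ z))
      ≡⟨ *-distribˡ-sumℤ D (λ m → A r m * signum (z m)) ⟩
    sumℤ (λ m → D * (A r m * signum (z m)))
      ≡⟨ sumℤ-cong (λ m → trans (lemma D (A r m) _) (cong (A r m *_) (scaled m))) ⟩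
    A r ⋅ z
      ≡⟨ ker r ⟩
    + 0 ∎)
    where
    open ≡-Reasoning
    D = + ∣ z j ∣
    D≢0 : D ≢ + 0
    D≢0 D≡0 = zj≢0 (ℤ.∣i∣≡0⇒i≡0 (cong ∣_∣ D≡0))
    scaled : ∀ m → D * signum (z m) ≡ z m
    scaled m with z-flat m
    ... | inj₁ zm≡0 rewrite zm≡0 = ℤ.*-zeroʳ D
    ... | inj₂ ∣zm∣≡ = trans (cong (λ t → + t * signum (z m)) (sym ∣zm∣≡)) (abs*signum (z m))
    lemma : ∀ d a s → d * (a * s) ≡ a * (d * s)
    lemma = solve-∀

  circuit-⊆ : ∀ {c x} → Circuit A c → InL A x → ¬ IsZero x → support x ⊆ support c → Circuit A x
  circuit-⊆ {c} {x} (_ , _ , c-min) ker x≢0 x⊆c = ker , x≢0 , λ c′ ker′ c′≢0 c′⊆x {m} m∈x →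
    c-min c′ ker′ c′≢0 (λ {y} y∈c′ → x⊆c (c′⊆x y∈c′)) (x⊆c m∈x)

module SignCircuit {d n : ℕ} (A : Matrix d n) (U : Unimodular A)
                   {c : Fin n → ℤ} (circuit : Circuit A c) {j : Fin n} (cj≢0 : c j ≢ + 0) where

  private
    c-ker = proj₁ circuit
    c≢0   = proj₁ (proj₂ circuit)
    c-min = proj₂ (proj₂ circuit)

  others? : Decidable (λ m → c m ≢ + 0 × m ≢ j)
  others? m = ¬? (c m ℤ.≟ + 0) ×-dec ¬? (m Fin.≟ j)

  others : Subset n
  others = subset others?

  others-independent : Independent A others
  others-independent c′ c′-supp c′-ker = decidable-stable (IsZero? c′) λ c′≢0 →
    let c′⊆c : support c′ ⊆ support c
        c′⊆c m∈c′ =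
          ∈-support⁺ {c = c} (proj₁ (∈-subset⁻ others? (supported⇒support⊆ {c = c′} c′-supp m∈c′)))
    in ∈-support⁻ {c = c′} (c-min c′ c′-ker c′≢0 (λ {x} → c′⊆c {x}) (∈-support⁺ {c = c} cj≢0))
                  (c′-supp j (λ j∈others → proj₂ (∈-subset⁻ others? j∈others) refl))

  module _ {J : Subset n} (others⊆J : others ⊆ J) (J-ind : Independent A J) (J-max : Maximal A J) where

    private
      S = J ∪ ⁅ j ⁆

      c-in-S : ∀ {m} → c m ≢ + 0 → m ∈ S
      c-in-S {m} cm≢0 with m Fin.≟ j
      ... | yes refl = q⊆p∪q J ⁅ j ⁆ (x∈⁅x⁆ j)
      ... | no  m≢j  = p⊆p∪q ⁅ j ⁆ (others⊆J (∈-subset⁺ others? (cm≢0 , m≢j)))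

      j∉J : j ∉ J
      j∉J j∈J = independent⇒¬dependent A J-ind (c , c-ker , c≢0 , λ m m∉J →
        decidable-stable (c m ℤ.≟ + 0) λ cm≢0 →
          Sum.[ m∉J , (λ m∈j → m∉J (subst (_∈ J) (sym (x∈⁅y⁆⇒x≡y j m∈j)) j∈J)) ]
            (x∈p∪q⁻ J ⁅ j ⁆ (c-in-S cm≢0)))

    -- Opaque, so that unification never unfolds the rank argument through the enumeration below.
    opaque
      |S|≡1+d : List.length (elements S) ≡ suc d
      |S|≡1+d = trans (length-elements-∪⁅⁆ j∉J) (cong suc (basis-size A (proj₁ U) J-ind J-max))

    open Enumeration (enumerate S |S|≡1+d)

    private
      z : Fin n → ℤ
      z = cramer A σ

      minorᶜ : Fin (suc d) → ℤ
      minorᶜ l = minor A (σ ∘ punchIn l)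

      minorᶜ-increasing : ∀ l → Increasing (σ ∘ punchIn l)
      minorᶜ-increasing l = ∘-increasing increasing (punchIn-increasing l)

      ∣z∘σ∣ : ∀ l → ∣ z (σ l) ∣ ≡ ∣ minorᶜ l ∣
      ∣z∘σ∣ l = trans (cong ∣_∣ (cramer-at A σ injective l)) (∣altSign*∣ l (minorᶜ l))

      j-index : Image σ j
      j-index = image⁺ (q⊆p∪q J ⁅ j ⁆ (x∈⁅x⁆ j))

      l₀ : Fin (suc d)
      l₀ = proj₁ j-index

      minorᶜ-l₀≢0 : minorᶜ l₀ ≢ + 0
      minorᶜ-l₀≢0 minor≡0 = independent⇒¬dependent A J-ind
        (dependent-mono A in-J (minor≡0⇒dependent A (increasing⇒injective (minorᶜ-increasing l₀)) minor≡0))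
        where
        in-J : ∀ {m} → Image (σ ∘ punchIn l₀) m → m ∈ J
        in-J (l , refl) with x∈p∪q⁻ J ⁅ j ⁆ (image⁻ (punchIn l₀ l , refl))
        ... | inj₁ ∈J = ∈J
        ... | inj₂ ∈j = contradiction (injective {punchIn l₀ l} {l₀} (trans (x∈⁅y⁆⇒x≡y j ∈j) (sym (proj₂ j-index))))
                                      (Fin.punchInᵢ≢i l₀ l)

      ∣zj∣≡ : ∣ z j ∣ ≡ ∣ minorᶜ l₀ ∣
      ∣zj∣≡ = trans (cong (∣_∣ ∘ z) (sym (proj₂ j-index))) (∣z∘σ∣ l₀)

      zj≢0 : z j ≢ + 0
      zj≢0 zj≡0 = minorᶜ-l₀≢0 (ℤ.∣i∣≡0⇒i≡0 (trans (sym ∣zj∣≡) (cong ∣_∣ zj≡0)))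

      z-flat : ∀ m → z m ≡ + 0 ⊎ ∣ z m ∣ ≡ ∣ z j ∣
      z-flat m with Fin.any? (λ l → σ l Fin.≟ m)
      ... | no  m∉σ        = inj₁ (cramer-supported A σ m m∉σ)
      ... | yes (l , refl) with minorᶜ l ℤ.≟ + 0
      ...   | yes minor≡0 = inj₁ (ℤ.∣i∣≡0⇒i≡0 (trans (∣z∘σ∣ l) (cong ∣_∣ minor≡0)))
      ...   | no  minor≢0 = inj₂ (begin
        ∣ z (σ l) ∣
          ≡⟨ ∣z∘σ∣ l ⟩
        ∣ minorᶜ l ∣
          ≡⟨ proj₂ U _ _ (minorᶜ-increasing l) (minorᶜ-increasing l₀) minor≢0 minorᶜ-l₀≢0 ⟩
        ∣ minorᶜ l₀ ∣
          ≡⟨ ∣zj∣≡ ⟨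
        ∣ z j ∣ ∎)
        where open ≡-Reasoning

      -- Where c vanishes, the complementary columns still carry the whole circuit c.
      z⊆c : ∀ m → c m ≡ + 0 → z m ≡ + 0
      z⊆c m cm≡0 with Fin.any? (λ l → σ l Fin.≟ m)
      ... | no  m∉σ        = cramer-supported A σ m m∉σ
      ... | yes (l , refl) = trans (cramer-at A σ injective l)
                               (j≡0⇒i*j≡0 (altSign l) minor≡0)
        where
        c-in-image : SupportedIn (Image (σ ∘ punchIn l)) c
        c-in-image m′ m′∉ = decidable-stable (c m′ ℤ.≟ + 0) λ cm′≢0 →
          let (l′ , σl′≡m′) = image⁺ (c-in-S cm′≢0)
              l≢l′ : l ≢ l′
              l≢l′ l≡l′ = cm′≢0 (trans (cong c (trans (sym σl′≡m′) (cong σ (sym l≡l′)))) cm≡0)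
          in m′∉ (punchOut l≢l′ , trans (cong σ (Fin.punchIn-punchOut l≢l′)) σl′≡m′)
        minor≡0 : minorᶜ l ≡ + 0
        minor≡0 = dependent⇒minor≡0 A (increasing⇒injective (minorᶜ-increasing l)) (c , c-ker , c≢0 , c-in-image)

    sign-circuit : ∃[ x ] Circuit A x × SignVector x × support x ⊆ support c
    sign-circuit = x , circuit-⊆ A circuit x-ker x≢0 (λ {m} → x⊆c {m}) , signum-sign ∘ z , λ {m} → x⊆c {m}
      where
      x = signum ∘ z
      x-ker : InL A x
      x-ker = signum-kernel A z j (cramer-kernel A σ) zj≢0 z-flat
      x≢0 : ¬ IsZero x
      x≢0 x≡0 = zj≢0 (signum≡0 (x≡0 j))
      x⊆c : support x ⊆ support c
      x⊆c {m} m∈x = ∈-support⁺ {c = c} λ cm≡0 → ∈-support⁻ {c = x} m∈x (cong signum (z⊆c m cm≡0))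

sign-circuit-below : ∀ {d n} (A : Matrix d n) → Unimodular A → ∀ {c} → Circuit A c →
                     ¬ ¬ (∃[ x ] Circuit A x × SignVector x × support x ⊆ support c)
sign-circuit-below A U {c} circuit with nonzero-entry? c
... | inj₁ c≡0 = contradiction c≡0 (proj₁ (proj₂ circuit))
... | inj₂ (j , cj≢0) = do
  (J , others⊆J , J-ind , J-max) ← extend-to-basis A (SignCircuit.others-independent A U circuit cj≢0)
  pure (SignCircuit.sign-circuit A U circuit cj≢0 (λ {x} → others⊆J {x}) J-ind J-max)

-- Graver elements

private
  nonneg-split : ∀ {a b} → + 0 ℤ.≤ a → + 0 ℤ.≤ b → a + b ℤ.≤ + 1 → a ≡ + 0 ⊎ b ≡ + 0
  nonneg-split {+ zero}            _ _ _                 = inj₁ refl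
  nonneg-split {+ suc p} {+ zero}  _ _ _                 = inj₂ refl
  nonneg-split {+ suc p} {+ suc q} _ _ (+≤+ (s≤s p+q<0)) = contradiction (ℕ.m+n≤o⇒n≤o p p+q<0) λ ()

orthant : ∀ {n} → (Fin n → ℤ) → Fin n → Sign
orthant x m = ℤ.sign (x m)

orthant-self : ∀ {n} (x : Fin n → ℤ) → InOrthant (orthant x) x
orthant-self x m = nonneg (x m) , nonpos (x m)
  where
  nonneg : ∀ t → ℤ.sign t ≡ Sign.+ → + 0 ℤ.≤ t
  nonneg (+ _) _ = +≤+ z≤n
  nonpos : ∀ t → ℤ.sign t ≡ Sign.- → t ℤ.≤ + 0
  nonpos -[1+ _ ] _ = -≤+

conformal-disjoint : ∀ {n} {x y z : Fin n → ℤ} → SignVector x →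
                     InOrthant (orthant x) y → InOrthant (orthant x) z → (∀ m → x m ≡ y m + z m) →
                     ∀ m → y m ≡ + 0 ⊎ z m ≡ + 0
conformal-disjoint {x = x} {y} {z} x-sign y-orth z-orth x≡y+z m with x-sign m
... | inj₁ xm≡0 = nonneg-split (proj₁ (y-orth m) (cong ℤ.sign xm≡0)) (proj₁ (z-orth m) (cong ℤ.sign xm≡0))
                               (ℤ.≤-trans (ℤ.≤-reflexive (trans (sym (x≡y+z m)) xm≡0)) (+≤+ z≤n))
... | inj₂ (inj₁ xm≡1) =
  nonneg-split (proj₁ (y-orth m) (cong ℤ.sign xm≡1)) (proj₁ (z-orth m) (cong ℤ.sign xm≡1))
               (ℤ.≤-reflexive (trans (sym (x≡y+z m)) xm≡1))
... | inj₂ (inj₂ xm≡-1) = Sum.map neg≡0 neg≡0 (nonneg-split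
      (ℤ.neg-mono-≤ (proj₂ (y-orth m) (cong ℤ.sign xm≡-1)))
      (ℤ.neg-mono-≤ (proj₂ (z-orth m) (cong ℤ.sign xm≡-1)))
      (ℤ.≤-reflexive (trans (sym (ℤ.neg-distrib-+ (y m) (z m))) (cong -_ (trans (sym (x≡y+z m)) xm≡-1)))))
  where
  neg≡0 : ∀ {t} → - t ≡ + 0 → t ≡ + 0
  neg≡0 {t} -t≡0 = trans (sym (ℤ.neg-involutive t)) (cong -_ -t≡0)

restrict : ∀ {n} → (Fin n → ℤ) → Subset n → Fin n → ℤ
restrict x T m with m ∈? T
... | yes _ = x m
... | no  _ = + 0

restrict-∉ : ∀ {n} (x : Fin n → ℤ) {T m} → m ∉ T → restrict x T m ≡ + 0
restrict-∉ x {T} {m} m∉T with m ∈? T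
... | yes m∈T = contradiction m∈T m∉T
... | no  _   = refl

restrict-vanishes : ∀ {n} (x : Fin n → ℤ) T m → x m ≡ + 0 → restrict x T m ≡ + 0
restrict-vanishes x T m xm≡0 with m ∈? T
... | yes _ = xm≡0
... | no  _ = refl

module _ {d n : ℕ} (A : Matrix d n) where

  Decomposition : (Fin n → Sign) → (Fin n → ℤ) → Set
  Decomposition ρ x = Σ (Fin n → ℤ) λ y → Σ (Fin n → ℤ) λ z →
    InCone A ρ y × InCone A ρ z × ¬ IsZero y × ¬ IsZero z × (∀ i → x i ≡ y i + z i)

  InL? : ∀ x → Dec (InL A x)
  InL? x = Fin.all? (λ i → (A · x) i ℤ.≟ + 0)

  -- A decidable substitute for decomposability, adequate for sign vectors.
  Splittable : (Fin n → ℤ) → Set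
  Splittable x = ∃[ T ] InL A (restrict x T) × ¬ IsZero (restrict x T) × ¬ IsZero (λ m → x m - restrict x T m)

  splittable? : ∀ x → Dec (Splittable x)
  splittable? x = anySubset? λ T →
    InL? (restrict x T) ×-dec ¬? (IsZero? (restrict x T)) ×-dec ¬? (IsZero? (λ m → x m - restrict x T m))

  -- Each summand of a conformal decomposition of a sign vector x is a restriction of x.
  decomposition⇒splittable : ∀ {x} → SignVector x → Decomposition (orthant x) x → Splittable x
  decomposition⇒splittable {x} x-sign (y , z , (y-ker , y-orth) , (z-ker , z-orth) , y≢0 , z≢0 , x≡y+z) =
    support y ,
    (λ i → trans (sumℤ-cong (λ m → cong (A i m *_) (restrict≡y m))) (y-ker i)) ,
    (λ r≡0 → y≢0 (λ m → trans (sym (restrict≡y m)) (r≡0 m))) ,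
    (λ d≡0 → z≢0 (λ m → trans (sym (difference≡z m)) (d≡0 m)))
    where
    restrict≡y : ∀ m → restrict x (support y) m ≡ y m
    restrict≡y m with m ∈? support y
    ... | no  m∉y = sym (support⊆⇒supported {F = support y} {c = y} (λ {m} m∈y → m∈y) m m∉y)
    ... | yes m∈y with conformal-disjoint x-sign y-orth z-orth x≡y+z m
    ...   | inj₁ ym≡0 = contradiction ym≡0 (∈-support⁻ {c = y} m∈y)
    ...   | inj₂ zm≡0 = trans (x≡y+z m) (trans (cong (λ t → y m + t) zm≡0) (ℤ.+-identityʳ (y m)))
    difference≡z : ∀ m → x m - restrict x (support y) m ≡ z m
    difference≡z m = begin
      x m - restrict x (support y) m ≡⟨ cong₂ _-_ (x≡y+z m) (restrict≡y m) ⟩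
      y m + z m - y m               ≡⟨ lemma (y m) (z m) ⟩
      z m                           ∎
      where
      open ≡-Reasoning
      lemma : ∀ a b → a + b - a ≡ b
      lemma = solve-∀

  circuit⇒¬splittable : ∀ {x} → Circuit A x → ¬ Splittable x
  circuit⇒¬splittable {x} (x-ker , x≢0 , x-min) (T , r-ker , r≢0 , d≢0) = d≢0 difference≡0
    where
    r = restrict x T
    r⊆x : support r ⊆ support x
    r⊆x = support-⊆ {c = x} {r} (restrict-vanishes x T)
    x⊆r = x-min r r-ker r≢0 (λ {m} → r⊆x {m})
    difference≡0 : ∀ m → x m - r m ≡ + 0
    difference≡0 m with m ∈? T
    ... | yes m∈T = ℤ.+-inverseʳ (x m)
    ... | no  m∉T with x m ℤ.≟ + 0
    ...   | yes xm≡0 = trans (ℤ.+-identityʳ (x m)) xm≡0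
    ...   | no  xm≢0 = contradiction (restrict-∉ x m∉T) (∈-support⁻ {c = r} (x⊆r (∈-support⁺ {c = x} xm≢0)))

-- Sign vectors are enumerated as pairs (positive part, negative part) of subsets.
indicator : ∀ {n} → Subset n → Fin n → ℤ
indicator P m with m ∈? P
... | yes _ = + 1
... | no  _ = + 0

signVector : ∀ {n} → Subset n → Subset n → Fin n → ℤ
signVector P N m = indicator P m - indicator N m

signVector-sign : ∀ {n} (P N : Subset n) → SignVector (signVector P N)
signVector-sign P N m with m ∈? P | m ∈? N
... | yes _ | yes _ = inj₁ refl
... | yes _ | no  _ = inj₂ (inj₁ refl)
... | no  _ | yes _ = inj₂ (inj₂ refl)
... | no  _ | no  _ = inj₁ refl

indicator-∈ : ∀ {n} {P : Subset n} {m} → m ∈ P → indicator P m ≡ + 1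
indicator-∈ {P = P} {m} m∈P with m ∈? P
... | yes _   = refl
... | no  m∉P = contradiction m∈P m∉P

indicator-∉ : ∀ {n} {P : Subset n} {m} → m ∉ P → indicator P m ≡ + 0
indicator-∉ {P = P} {m} m∉P with m ∈? P
... | yes m∈P = contradiction m∈P m∉P
... | no  _   = refl

positives negatives : ∀ {n} → (Fin n → ℤ) → Subset n
positives x = subset (λ m → x m ℤ.≟ + 1)
negatives x = subset (λ m → x m ℤ.≟ - + 1)

signVector-complete : ∀ {n} {x : Fin n → ℤ} → SignVector x →
                      ∀ m → signVector (positives x) (negatives x) m ≡ x m
signVector-complete {x = x} x-sign m with x-sign m
... | inj₁ xm≡0 = begin
  indicator (positives x) m - indicator (negatives x) m  ≡⟨ cong₂ _-_ (indicator-∉ ∉P) (indicator-∉ ∉N) ⟩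
  + 0                                                    ≡⟨ xm≡0 ⟨
  x m                                                    ∎
  where
  open ≡-Reasoning
  ∉P : m ∉ positives x
  ∉P m∈P with () ← trans (sym xm≡0) (∈-subset⁻ (λ m → x m ℤ.≟ + 1) m∈P)
  ∉N : m ∉ negatives x
  ∉N m∈N with () ← trans (sym xm≡0) (∈-subset⁻ (λ m → x m ℤ.≟ - + 1) m∈N)
... | inj₂ (inj₁ xm≡1) = begin
  indicator (positives x) m - indicator (negatives x) m
    ≡⟨ cong₂ _-_ (indicator-∈ (∈-subset⁺ (λ m → x m ℤ.≟ + 1) xm≡1)) (indicator-∉ ∉N) ⟩
  + 1                                                    ≡⟨ xm≡1 ⟨
  x m                                                    ∎
  where
  open ≡-Reasoning
  ∉N : m ∉ negatives x
  ∉N m∈N with () ← trans (sym xm≡1) (∈-subset⁻ (λ m → x m ℤ.≟ - + 1) m∈N)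
... | inj₂ (inj₂ xm≡-1) = begin
  indicator (positives x) m - indicator (negatives x) m
    ≡⟨ cong₂ _-_ (indicator-∉ ∉P) (indicator-∈ (∈-subset⁺ (λ m → x m ℤ.≟ - + 1) xm≡-1)) ⟩
  - + 1                                                  ≡⟨ xm≡-1 ⟨
  x m                                                    ∎
  where
  open ≡-Reasoning
  ∉P : m ∉ positives x
  ∉P m∈P with () ← trans (sym xm≡-1) (∈-subset⁻ (λ m → x m ℤ.≟ + 1) m∈P)

module _ {d n : ℕ} (A : Matrix d n) where

  Candidate : Subset n → (Fin n → ℤ) → Set
  Candidate F x = InL A x × ¬ IsZero x × SupportedIn (_∈ F) x × ¬ Splittable A x

  candidate? : ∀ F x → Dec (Candidate F x)
  candidate? F x = InL? A x ×-dec ¬? (IsZero? x) ×-dec Fin.all? (λ m → ¬? (m ∈? F) →-dec (x m ℤ.≟ + 0))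
                   ×-dec ¬? (splittable? A x)

  candidate-resp : ∀ {F x x′} → (∀ m → x m ≡ x′ m) → Candidate F x → Candidate F x′
  candidate-resp {F} {x} {x′} x≗x′ (x-ker , x≢0 , x-supp , ¬split) =
    (λ i → trans (sumℤ-cong (λ m → cong (A i m *_) (sym (x≗x′ m)))) (x-ker i)) ,
    (λ x′≡0 → x≢0 (λ m → trans (x≗x′ m) (x′≡0 m))) ,
    (λ m m∉F → trans (sym (x≗x′ m)) (x-supp m m∉F)) ,
    λ (T , r-ker , r≢0 , d≢0) → ¬split (T ,
      (λ i → trans (sumℤ-cong (λ m → cong (A i m *_) (restrict≗ T m))) (r-ker i)) ,
      (λ r≡0 → r≢0 (λ m → trans (sym (restrict≗ T m)) (r≡0 m))) ,
      (λ d≡0 → d≢0 (λ m → trans (cong₂ _-_ (sym (x≗x′ m)) (sym (restrict≗ T m))) (d≡0 m))))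
    where
    restrict≗ : ∀ T m → restrict x T m ≡ restrict x′ T m
    restrict≗ T m with m ∈? T
    ... | yes _ = x≗x′ m
    ... | no  _ = refl

  sign-circuit⇒candidate : ∀ {F x} → Circuit A x → support x ⊆ F → Candidate F x
  sign-circuit⇒candidate {F} {x} x-circuit@(x-ker , x≢0 , _) x⊆F =
    x-ker , x≢0 , support⊆⇒supported {F = F} {c = x} x⊆F , circuit⇒¬splittable A x-circuit

  ¬independent⇒candidate : Unimodular A → ∀ {F} → ¬ Independent A F →
                           ¬ ¬ (∃[ P ] ∃[ N ] Candidate F (signVector P N))
  ¬independent⇒candidate U {F} ¬ind = do
    (c , c-ker , c≢0 , c-supp)       ← ¬independent⇒dependent A ¬ind
    (c′ , c′-circuit , c′⊆c)         ← circuit-below A c c-ker c≢0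
    (x , x-circuit , x-sign , x⊆c′)  ← sign-circuit-below A U c′-circuit
    let x⊆F : support x ⊆ F
        x⊆F x∈ = supported⇒support⊆ {F = F} {c = c} c-supp (c′⊆c (x⊆c′ x∈))
    pure (positives x , negatives x ,
          candidate-resp (sym ∘ signVector-complete x-sign) (sign-circuit⇒candidate x-circuit (λ {m} → x⊆F {m})))

  candidate-graver : ∀ {F x} → SignVector x → Candidate F x → InGraver A x
  candidate-graver {x = x} x-sign (x-ker , x≢0 , _ , ¬split) =
    orthant x , (x-ker , orthant-self x) , x≢0 , ¬split ∘ decomposition⇒splittable A x-sign

  -- The double-negated existence of a candidate is turned into one by exhaustive search.
  stanleyReisner⊆product : Unimodular A → ∀ w → InStanleyReisner A w → InProductIdeal A w
  stanleyReisner⊆product U w (F , ¬ind , w≥1)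
    with P , N , g-candidate ← decidable-stable (anySubset? λ P → anySubset? λ N → candidate? F (signVector P N))
                                               (¬independent⇒candidate U ¬ind)
    = g , candidate-graver (signVector-sign P N) g-candidate , g≤w
    where
    g = signVector P N
    g-in-F : ∀ {i} → g i ≢ + 0 → i ∈ F
    g-in-F = supported⇒support⊆ {F = F} {c = g} (proj₁ (proj₂ (proj₂ g-candidate))) ∘ ∈-support⁺ {c = g}
    g≤w : ∀ i → pos (g i) ℕ.+ neg (g i) ℕ.≤ w i
    g≤w i with signVector-sign P N i
    ... | inj₁ gi≡0         rewrite gi≡0  = z≤n
    ... | inj₂ (inj₁ gi≡1)  rewrite gi≡1  = w≥1 i (g-in-F (subst (_≢ + 0) (sym gi≡1) λ ()))
    ... | inj₂ (inj₂ gi≡-1) rewrite gi≡-1 = w≥1 i (g-in-F (subst (_≢ + 0) (sym gi≡-1) λ ()))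

-- Fibers and vertices

toℚ-homo-+ : ∀ a b → toℚ (a ℕ.+ b) ≡ toℚ a ℚ.+ toℚ b
toℚ-homo-+ a b = ℚ.toℚᵘ-injective (begin
  ℚ.toℚᵘ (toℚ (a ℕ.+ b))
    ≈⟨ ℚ.toℚᵘ-fromℚᵘ (mkℚᵘ (+ (a ℕ.+ b)) 0) ⟩
  mkℚᵘ (+ (a ℕ.+ b)) 0
    ≈⟨ *≡* (lemma (+ a) (+ b)) ⟩
  mkℚᵘ (+ a) 0 ℚᵘ.+ mkℚᵘ (+ b) 0
    ≈⟨ ℚᵘ.+-cong (ℚ.toℚᵘ-fromℚᵘ (mkℚᵘ (+ a) 0)) (ℚ.toℚᵘ-fromℚᵘ (mkℚᵘ (+ b) 0)) ⟨
  ℚ.toℚᵘ (toℚ a) ℚᵘ.+ ℚ.toℚᵘ (toℚ b)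
    ≈⟨ ℚ.toℚᵘ-homo-+ (toℚ a) (toℚ b) ⟨
  ℚ.toℚᵘ (toℚ a ℚ.+ toℚ b) ∎)
  where
  open ℚᵘ.≃-Reasoning
  lemma : ∀ x y → (x + y) * + 1 ≡ (x * + 1 + y * + 1) * + 1
  lemma = solve-∀

midpoint : ∀ x y w → x ℚ.+ y ≡ w ℚ.+ w → ½ ℚ.* x ℚ.+ (½ ℚ.* y ℚ.+ 0ℚ) ≡ w
midpoint x y w x+y≡2w = begin
  ½ ℚ.* x ℚ.+ (½ ℚ.* y ℚ.+ 0ℚ)  ≡⟨ factor x y ⟩
  ½ ℚ.* (x ℚ.+ y)              ≡⟨ cong (½ ℚ.*_) x+y≡2w ⟩
  ½ ℚ.* (w ℚ.+ w)              ≡⟨ halve w ⟩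
  w                            ∎
  where
  open ≡-Reasoning
  open +-*-Solver
  factor : ∀ x y → ½ ℚ.* x ℚ.+ (½ ℚ.* y ℚ.+ 0ℚ) ≡ ½ ℚ.* (x ℚ.+ y)
  factor = solve 2 (λ x y → con ½ :* x :+ (con ½ :* y :+ con 0ℚ) := con ½ :* (x :+ y)) refl
  halve : ∀ w → ½ ℚ.* (w ℚ.+ w) ≡ w
  halve = solve 1 (λ w → con ½ :* (w :+ w) := w) refl

pos-neg : ∀ t → pos (- t) ≡ neg t
pos-neg (+ zero)  = refl
pos-neg (+ suc _) = refl
pos-neg -[1+ _ ]  = refl

neg-neg : ∀ t → neg (- t) ≡ pos t
neg-neg (+ zero)  = refl
neg-neg (+ suc _) = refl
neg-neg -[1+ _ ]  = refl

+-bounded-nonneg : ∀ k t → pos t ℕ.+ neg t ℕ.≤ k → + 0 ℤ.≤ + k + t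
+-bounded-nonneg k (+ p)     _     = +≤+ z≤n
+-bounded-nonneg k -[1+ p ] 1+p≤k = subst (+ 0 ℤ.≤_) (sym (ℤ.⊖-≥ 1+p≤k)) (+≤+ z≤n)

-bounded-nonneg : ∀ k t → pos t ℕ.+ neg t ℕ.≤ k → + 0 ℤ.≤ + k - t
-bounded-nonneg k t bound = +-bounded-nonneg k (- t)
  (subst (ℕ._≤ k) (trans (ℕ.+-comm (pos t) (neg t)) (sym (cong₂ ℕ._+_ (pos-neg t) (neg-neg t)))) bound)

x+y≡x⇒y≡0 : ∀ {x y} → x + y ≡ x → y ≡ + 0
x+y≡x⇒y≡0 {x} {y} x+y≡x = begin
  y             ≡⟨ lemma x y ⟩
  x + y - x     ≡⟨ cong (_- x) x+y≡x ⟩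
  x - x         ≡⟨ ℤ.+-inverseʳ x ⟩
  + 0           ∎
  where
  open ≡-Reasoning
  lemma : ∀ x y → y ≡ x + y - x
  lemma = solve-∀

translate : ∀ {n} → Exp n → (Fin n → ℤ) → Exp n
translate w g i = ∣ + w i + g i ∣

module _ {d n : ℕ} (A : Matrix d n) where

  module _ {w : Exp n} {g : Fin n → ℤ} (nonneg : ∀ i → + 0 ℤ.≤ + w i + g i) where

    toℤ-translate : ∀ i → + translate w g i ≡ + w i + g i
    toℤ-translate i = ℤ.0≤i⇒+∣i∣≡i (nonneg i)

    translate-fiber : InL A g → InFiber A w (translate w g)
    translate-fiber g-ker r = begin
      A r ⋅ toℤ (translate w g)
        ≡⟨ sumℤ-cong (λ i → cong (A r i *_) (toℤ-translate i)) ⟩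
      sumℤ (λ i → A r i * (+ w i + g i))
        ≡⟨ sumℤ-cong (λ i → ℤ.*-distribˡ-+ (A r i) (+ w i) (g i)) ⟩
      sumℤ (λ i → A r i * + w i + A r i * g i)
        ≡⟨ sumℤ-distrib-+ (λ i → A r i * + w i) (λ i → A r i * g i) ⟩
      A r ⋅ toℤ w + A r ⋅ g
        ≡⟨ cong (λ t → A r ⋅ toℤ w + t) (g-ker r) ⟩
      A r ⋅ toℤ w + + 0
        ≡⟨ ℤ.+-identityʳ _ ⟩
      A r ⋅ toℤ w ∎
      where open ≡-Reasoning

    translate-moves : ¬ IsZero g → ¬ (∀ i → translate w g i ≡ w i)
    translate-moves g≢0 fixed = g≢0 λ i → x+y≡x⇒y≡0 (trans (sym (toℤ-translate i)) (cong +_ (fixed i)))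

  neg-kernel : ∀ g → InL A g → InL A (λ i → - g i)
  neg-kernel g g-ker r = begin
    sumℤ (λ i → A r i * - g i)    ≡⟨ sumℤ-cong (λ i → sym (ℤ.neg-distribʳ-* (A r i) (g i))) ⟩
    sumℤ (λ i → - (A r i * g i))  ≡⟨ sumℤ-neg (λ i → A r i * g i) ⟩
    - (A r ⋅ g)                   ≡⟨ cong -_ (g-ker r) ⟩
    + 0                           ∎
    where open ≡-Reasoning

  product⊆vertex : ∀ w → InProductIdeal A w → InVertexIdeal A w
  product⊆vertex w (g , (_ , (g-ker , _) , g≢0 , _) , g≤w) ¬conv = ¬conv
    ( (½ , translate w g) ∷ (½ , translate w -g) ∷ []
    , (0≤½ , translate-fiber up g-ker , translate-moves up g≢0)
      ∷ (0≤½ , translate-fiber down (neg-kernel g g-ker) , translate-moves down -g≢0) ∷ []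
    , refl
    , λ i → midpoint (toℚ (translate w g i)) (toℚ (translate w -g i)) (toℚ (w i)) (sum≡ i))
    where
    -g = λ i → - g i
    up : ∀ i → + 0 ℤ.≤ + w i + g i
    up i = +-bounded-nonneg (w i) (g i) (g≤w i)
    down : ∀ i → + 0 ℤ.≤ + w i + -g i
    down i = -bounded-nonneg (w i) (g i) (g≤w i)
    -g≢0 : ¬ IsZero -g
    -g≢0 -g≡0 = g≢0 (λ i → trans (sym (ℤ.neg-involutive (g i))) (cong -_ (-g≡0 i)))
    0≤½ : 0ℚ ℚ.≤ ½
    0≤½ = toWitness {a? = 0ℚ ℚ.≤? ½} tt
    sum≡ : ∀ i → toℚ (translate w g i) ℚ.+ toℚ (translate w -g i) ≡ toℚ (w i) ℚ.+ toℚ (w i)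
    sum≡ i = begin
      toℚ (translate w g i) ℚ.+ toℚ (translate w -g i)  ≡⟨ toℚ-homo-+ (translate w g i) (translate w -g i) ⟨
      toℚ (translate w g i ℕ.+ translate w -g i)        ≡⟨ cong toℚ (ℤ.+-injective (sum-in-ℤ)) ⟩
      toℚ (w i ℕ.+ w i)                                  ≡⟨ toℚ-homo-+ (w i) (w i) ⟩
      toℚ (w i) ℚ.+ toℚ (w i)                            ∎
      where
      open ≡-Reasoning
      lemma : ∀ x y → x + y + (x + - y) ≡ x + x
      lemma = solve-∀
      sum-in-ℤ : + (translate w g i ℕ.+ translate w -g i) ≡ + (w i ℕ.+ w i)
      sum-in-ℤ = trans (cong₂ _+_ (toℤ-translate {w} {g} up i) (toℤ-translate {w} { -g} down i)) (lemma (+ w i) (g i))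

module _ {X : Set} (f : X → ℚ) where

  sumℚ-nonneg : ∀ cs → All (λ c → 0ℚ ℚ.≤ f c) cs → 0ℚ ℚ.≤ sumℚ (map f cs)
  sumℚ-nonneg []       []            = ℚ.≤-refl
  sumℚ-nonneg (c ∷ cs) (fc≥0 ∷ rest) = subst (ℚ._≤ f c ℚ.+ sumℚ (map f cs)) (ℚ.+-identityˡ 0ℚ)
                                             (ℚ.+-mono-≤ fc≥0 (sumℚ-nonneg cs rest))

  sumℚ-pos : ∀ cs → All (λ c → 0ℚ ℚ.≤ f c) cs → ∀ {c} → c ∈ₗ cs → 0ℚ ℚ.< f c →
             0ℚ ℚ.< sumℚ (map f cs)
  sumℚ-pos (c ∷ cs) (_ ∷ rest) (here refl) fc>0 =
    subst (ℚ._< f c ℚ.+ sumℚ (map f cs)) (ℚ.+-identityˡ 0ℚ) (ℚ.+-mono-<-≤ fc>0 (sumℚ-nonneg cs rest))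
  sumℚ-pos (c′ ∷ cs) (fc′≥0 ∷ rest) (there c∈cs) fc>0 =
    subst (ℚ._< f c′ ℚ.+ sumℚ (map f cs)) (ℚ.+-identityˡ 0ℚ)
          (ℚ.+-mono-≤-< fc′≥0 (sumℚ-pos cs rest c∈cs fc>0))

sumℚ-zeros : ∀ {X : Set} (cs : List (ℚ × X)) → All (λ c → proj₁ c ≡ 0ℚ) cs →
             sumℚ (map proj₁ cs) ≡ 0ℚ
sumℚ-zeros []       []            = refl
sumℚ-zeros (c ∷ cs) (c≡0 ∷ rest) rewrite c≡0 | sumℚ-zeros cs rest = refl

private
  nonneg* : ∀ {a b} → 0ℚ ℚ.≤ a → 0ℚ ℚ.≤ b → 0ℚ ℚ.≤ a ℚ.* b
  nonneg* {a} {b} a≥0 b≥0 =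
    ℚ.nonNegative⁻¹ (a ℚ.* b) {{ℚ.nonNeg*nonNeg⇒nonNeg a {{ℚ.nonNegative a≥0}} b {{ℚ.nonNegative b≥0}}}}

  pos* : ∀ {a b} → 0ℚ ℚ.< a → 0ℚ ℚ.< b → 0ℚ ℚ.< a ℚ.* b
  pos* {a} {b} a>0 b>0 = ℚ.positive⁻¹ (a ℚ.* b) {{ℚ.pos*pos⇒pos a {{ℚ.positive a>0}} b {{ℚ.positive b>0}}}}

  toℚ-nonneg : ∀ k → 0ℚ ℚ.≤ toℚ k
  toℚ-nonneg k = ℚ.nonNegative⁻¹ (toℚ k) {{ℚ.normalize-nonNeg k 1}}

  toℚ-pos : ∀ k → 0ℚ ℚ.< toℚ (suc k)
  toℚ-pos k = ℚ.positive⁻¹ (toℚ (suc k)) {{ℚ.normalize-pos (suc k) 1}}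

  nonneg-≢0 : ∀ {a} → 0ℚ ℚ.≤ a → a ≢ 0ℚ → 0ℚ ℚ.< a
  nonneg-≢0 {a} a≥0 a≢0 with ℚ.<-cmp 0ℚ a
  ... | tri< 0<a _ _ = 0<a
  ... | tri≈ _ 0≡a _ = contradiction (sym 0≡a) a≢0
  ... | tri> _ _ a<0 = contradiction (ℚ.<-≤-trans a<0 a≥0) (ℚ.<-irrefl refl)

module _ {d n : ℕ} (A : Matrix d n) where

  private
    positive-weight : ∀ {X : Set} (cs : List (ℚ × X)) → sumℚ (map proj₁ cs) ≡ 1ℚ →
                      ∃[ c ] c ∈ₗ cs × proj₁ c ≢ 0ℚ
    positive-weight cs Σ≡1 with Any.any? (λ c → ¬? (proj₁ c ℚ.≟ 0ℚ)) cs
    ... | yes some    = find some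
    ... | no  ¬some   = contradiction (trans (sym (sumℚ-zeros cs all-zero)) Σ≡1) λ ()
      where all-zero = All.map (decidable-stable (_ ℚ.≟ 0ℚ)) (All.¬Any⇒All¬ cs ¬some)

  support-independent⇒vertex : ∀ w → Independent A (subset (λ i → 1 ℕ.≤? w i)) → IsVertex A w
  support-independent⇒vertex w F-ind (cs , cs-valid , Σλ≡1 , coords)
    with (λc , v) , c∈cs , λc≢0 ← positive-weight cs Σλ≡1
    with λc≥0 , v-fiber , v≢w ← All.lookup cs-valid c∈cs
    = v≢w λ i → ℤ.+-injective (ℤ.i-j≡0⇒i≡j _ _ (u≡0 i))
    where
    F? = λ i → 1 ℕ.≤? w i
    v-vanishes : ∀ i → w i ≡ 0 → v i ≡ 0
    v-vanishes i wi≡0 with v i in vi≡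
    ... | zero  = refl
    ... | suc k = contradiction (sym (trans (coords i) (cong toℚ wi≡0))) (ℚ.<⇒≢ Σ>0)
      where
      f : ℚ × Exp n → ℚ
      f c = proj₁ c ℚ.* toℚ (proj₂ c i)
      Σ>0 : 0ℚ ℚ.< sumℚ (map f cs)
      Σ>0 = sumℚ-pos f cs (All.map (λ {c} (λ≥0 , _) → nonneg* λ≥0 (toℚ-nonneg (proj₂ c i))) cs-valid) c∈cs
              (pos* (nonneg-≢0 λc≥0 λc≢0) (subst (λ t → 0ℚ ℚ.< toℚ t) (sym vi≡) (toℚ-pos k)))
    u : Fin n → ℤ
    u i = + v i - + w i
    u-ker : InL A u
    u-ker r = begin
      sumℤ (λ i → A r i * (+ v i - + w i))
        ≡⟨ sumℤ-cong (λ i → lemma (A r i) (+ v i) (+ w i)) ⟩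
      sumℤ (λ i → A r i * + v i - A r i * + w i)
        ≡⟨ sumℤ-distrib-- (λ i → A r i * + v i) (λ i → A r i * + w i) ⟩
      A r ⋅ toℤ v - A r ⋅ toℤ w
        ≡⟨ cong (_- A r ⋅ toℤ w) (v-fiber r) ⟩
      A r ⋅ toℤ w - A r ⋅ toℤ w
        ≡⟨ ℤ.+-inverseʳ (A r ⋅ toℤ w) ⟩
      + 0 ∎
      where
      open ≡-Reasoning
      lemma : ∀ a x y → a * (x - y) ≡ a * x - a * y
      lemma = solve-∀
    u-supp : SupportedIn (_∈ subset F?) u
    u-supp i i∉F = cong₂ (λ a b → + a - + b) (v-vanishes i wi≡0) wi≡0
      where wi≡0 = ℕ.n<1⇒n≡0 (ℕ.≰⇒> (i∉F ∘ ∈-subset⁺ F?))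
    u≡0 : IsZero u
    u≡0 = F-ind u u-supp u-ker

  vertex⊆stanleyReisner : ∀ w → InVertexIdeal A w → InStanleyReisner A w
  vertex⊆stanleyReisner w ¬vertex = subset F? , ¬vertex ∘ support-independent⇒vertex w , λ i → ∈-subset⁻ F?
    where F? = λ i → 1 ℕ.≤? w i

proposition4p2 : ∀ {d n} (A : Matrix d n) → Unimodular A →
                   (∀ (w : Exp n) → InProductIdeal A w ⇔ InVertexIdeal A w) ×
                   (∀ (w : Exp n) → InVertexIdeal A w ⇔ InStanleyReisner A w)
proposition4p2 A U =
  (λ w → mk⇔ (product⊆vertex A w) (stanleyReisner⊆product A U w ∘ vertex⊆stanleyReisner A w)) ,
  (λ w → mk⇔ (vertex⊆stanleyReisner A w) (product⊆vertex A w ∘ stanleyReisner⊆product A U w))
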